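{- Let $\mathcal A$ be a cyclotomic S-ring with trivial radical over a finite cyclic group $G$, and let $S$ be an $\mathcal A$-section such that $S_p\ne 1$ for every odd prime divisor $p$ of $|G|$. Then: (1) $|\mathrm{rad}(\mathcal A_S)|\le 2$; (2) $|\mathrm{rad}(\mathcal A_S)|=1$ unless $|S_2|=4$.
   Context: An S-ring over a finite group $G$ is a subring $\mathcal A$ of $\mathbb Z G$ spanned by the sums $\underline X=\sum_{x\in X}x$ over the blocks $X$ of a partition of $G$ (basic sets) containing $\{e\}$ and closed under $X\mapsto X^{ -1}$. An $\mathcal A$-group is a subgroup that is a union of basic sets; an $\mathcal A$-section is $U/L$ with $L\le U$ $\mathcal A$-groups, with restriction $\mathcal A_{U/L}$ the S-ring over $U/L$ whose basic sets are the images of basic sets contained in $U$. $\mathcal A$ is cyclotomic if its basic sets are the orbits of some subgroup of $\mathrm{Aut}(G)$. For $X\subseteq G$, $\mathrm{rad}(X)=\{g: gX=X\}$; for an S-ring over a cyclic group, its radical is the radical of any basic set containing a generator of the group. For a cyclic group $S$ and prime $p$, $S_p$ denotes its Sylow $p$-subgroup. -}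

module Defs where

open import Data.Nat using (ℕ; zero; suc; _+_; _*_; _∸_; _<_; _≤_; _≡ᵇ_; _<ᵇ_; _≤ᵇ_; NonZero)
open import Data.Nat.DivMod using (_%_)
open import Data.Nat.Coprimality using (Coprime)
open import Data.Bool using (Bool; true; false; _∧_; _∨_; not; T)
open import Data.List using (List; upTo; length; filterᵇ)
open import Data.Bool.ListAction using (any; all)
open import Data.Product using (_×_; Σ; ∃)
open import Relation.Binary.PropositionalEquality using (_≡_)

-- The cyclic group G = ℤ/nℤ is modelled by the residues 0 … n-1 (naturals < n),
-- with group law (a + b) % n.  Subsets of G (and of ℤ) are Boolean predicates on ℕ.

Subset : Set
Subset = ℕ → Bool

anyBelow : ℕ → (ℕ → Bool) → Bool
anyBelow n f = any f (upTo n)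

allBelow : ℕ → (ℕ → Bool) → Bool
allBelow n f = all f (upTo n)

_⇒ᵇ_ : Bool → Bool → Bool
a ⇒ᵇ b = not a ∨ b

countBelow : ℕ → (ℕ → Bool) → ℕ
countBelow n f = length (filterᵇ f (upTo n))

module _ (n : ℕ) .{{_ : NonZero n}} where

  wholeG : Subset
  wholeG x = x <ᵇ n

  trivialG : Subset
  trivialG x = x ≡ᵇ 0

  -- K is a subgroup of Aut(G) = (ℤ/nℤ)^×, the automorphism k acting by x ↦ k·x mod n
  record IsAutSubgroup (K : Subset) : Set where
    field
      units   : ∀ k → T (K k) → k < n × Coprime k n
      one     : T (K (1 % n))
      mulClos : ∀ k k′ → T (K k) → T (K k′) → T (K ((k * k′) % n))
      invClos : ∀ k → T (K k) → Σ ℕ (λ k′ → T (K k′) × ((k * k′) % n ≡ 1 % n))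

  record IsSubgroup (H : Subset) : Set where
    field
      inG     : ∀ x → T (H x) → x < n
      zero∈   : T (H 0)
      addClos : ∀ a b → T (H a) → T (H b) → T (H ((a + b) % n))
      negClos : ∀ a → T (H a) → T (H ((n ∸ a) % n))

  -- For the cyclotomic S-ring A determined by K, the basic sets are the K-orbits
  -- {k·x mod n : k ∈ K}.  An A-group is a subgroup that is a union of basic sets,
  -- i.e. a subgroup closed under the action of K.
  record IsAGroup (K H : Subset) : Set where
    field
      subgroup  : IsSubgroup H
      unionOrbs : ∀ k x → T (K k) → T (H x) → T (H ((k * x) % n))

  isCanonRep : Subset → ℕ → Bool
  isCanonRep L g = allBelow n (λ l → L l ⇒ᵇ (g ≤ᵇ ((g + l) % n)))

  -- |U/L| : the number of cosets of L contained in U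
  secOrder : Subset → Subset → ℕ
  secOrder U L = countBelow n (λ g → U g ∧ isCanonRep L g)

  -- the image of u ∈ U generates U/L
  isGenerator : Subset → Subset → ℕ → Bool
  isGenerator U L u =
    allBelow n (λ v → U v ⇒ᵇ
      anyBelow n (λ m → anyBelow n (λ l → L l ∧ (((m * u) + l) % n ≡ᵇ v))))

  -- the preimage in U of the basic set of A_{U/L} containing u + L,
  -- i.e. the union of the cosets k·u + L, k ∈ K
  basicPre : Subset → Subset → ℕ → Subset
  basicPre K L u x =
    anyBelow n (λ k → K k ∧ anyBelow n (λ l → L l ∧ (((k * u) + l) % n ≡ᵇ x)))

  stabilises : Subset → ℕ → Bool
  stabilises Y g =
    allBelow n (λ x → Y x ⇒ᵇ (Y ((g + x) % n)
                              ∧ anyBelow n (λ y → Y y ∧ (((g + y) % n) ≡ᵇ x))))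

  -- |rad(X)| where X is the basic set of A_{U/L} containing u + L:
  -- the number of cosets g + L (g ∈ U) with (g + L) + X = X
  radCount : Subset → Subset → Subset → ℕ → ℕ
  radCount K U L u =
    countBelow n (λ g → U g ∧ isCanonRep L g ∧ stabilises (basicPre K L u) g)

module Submission where

-- Every A-group is cℤ/nℤ for a divisor c of n, so the section S = U/L is cyclic of order
-- s = cL/cU, generated by u = w·cU with w a unit modulo s. An element g = j·cU lies in the radical
-- of the basic set K·u + L exactly when K contains, modulo s, the coset 1 + (j/w)ℤ.
-- Key lemma: if K contains 1 + Bℤ modulo s = B·p with p prime, then p ∣ B (elements of K are
-- units), and raising an element 1 + B·c of K (p ∤ c) to the prime factors q of n/s lifts it,
-- via (1 + X)^q ≡ 1 + qX, to an element ≡ 1 + (n/p)·c′ modulo n; then n/p is a nonzero period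
-- of K, contradicting the trivial radical. The lifting uses that every odd prime factor of n
-- divides s, and breaks down only for p = 2 with 4 ∤ B, i.e. when 4 ∥ s. Applied to
-- d = gcd(j, s), this forces s/d ≤ 2, so the radical is {0} or {0, cL/2}, the latter only if 4 ∥ s.


open import Defs
open import Data.Nat
open import Data.Nat.Properties
open import Data.Nat.DivMod hiding (_mod_)
open import Data.Nat.Divisibility
open import Data.Nat.Tactic.RingSolver using (solve-∀)
open import Data.Nat.Induction using (<-wellFounded)
open import Induction.WellFounded using (Acc; acc)
open import Data.Nat.Primality using (Prime; prime[2]; euclidsLemma; prime⇒irreducible; prime⇒nonTrivial; prime⇒nonZero)
open import Data.Nat.Primality.Factorisation using (factorise; PrimeFactorisation)
open import Data.Nat.Coprimality using (Coprime; coprime-Bézout)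
import Data.Nat.Coprimality as Coprime
open import Data.Nat.GCD using (module Bézout; module GCD)
open import Data.Nat.ListAction using (product)
open import Data.List.Relation.Unary.All using (All; []; _∷_)
open import Data.Product using (∃; ∃₂; _×_; _,_; proj₁; proj₂)
open import Data.Sum using (_⊎_; inj₁; inj₂; [_,_]′)
import Data.Sum as Sum
open import Data.Empty using (⊥-elim)
open import Data.Bool using (Bool; true; false; T; _∧_; not; if_then_else_)
import Data.Bool.Properties as Bool
open import Data.List using (upTo; length; filterᵇ; _++_; [_]; []; _∷_)
open import Data.List.Properties using (upTo-∷ʳ; filter-++; length-++)
open import Data.Bool.ListAction using (all; any)
import Data.List.Relation.Unary.All as All
open import Data.List.Relation.Unary.All.Properties using (all⁺; all⁻)
open import Data.List.Relation.Unary.Any.Properties using (any⁺; any⁻)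
open import Data.List.Membership.Propositional using (lose; find)
open import Data.List.Membership.Propositional.Properties using (∈-upTo⁺; ∈-upTo⁻)
open import Function.Base using (_∘_; _$_; id)
open import Function.Bundles using (Equivalence; _⇔_; mk⇔)
open import Relation.Nullary.Decidable using (T?; does; dec-true; dec-false; isYes; toWitness; fromWitness)
open import Relation.Nullary using (¬_; yes; no)
open import Relation.Binary.Bundles using (Setoid)
import Relation.Binary.Reasoning.Setoid as SetoidReasoning
open import Relation.Binary.PropositionalEquality
  using (_≡_; _≢_; refl; sym; trans; cong; cong₂; subst; subst₂; module ≡-Reasoning)

-- Congruences

infix 4 _≡_mod_

-- Witnessed without subtraction or division, so no NonZero instance is needed.
_≡_mod_ : ℕ → ℕ → ℕ → Set
_≡_mod_ a b m = ∃₂ λ x y → a + x * m ≡ b + y * m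

module _ {m : ℕ} where

  mod-refl : ∀ {a} → a ≡ a mod m
  mod-refl = 0 , 0 , refl

  mod-reflexive : ∀ {a b} → a ≡ b → a ≡ b mod m
  mod-reflexive refl = mod-refl

  mod-sym : ∀ {a b} → a ≡ b mod m → b ≡ a mod m
  mod-sym (x , y , e) = y , x , sym e

  mod-trans : ∀ {a b c} → a ≡ b mod m → b ≡ c mod m → a ≡ c mod m
  mod-trans {a} {b} {c} (x , y , e) (z , w , f) = x + z , y + w , (begin
      a + (x + z) * m      ≡⟨ lemma a x z m ⟩
      (a + x * m) + z * m  ≡⟨ cong (_+ z * m) e ⟩
      (b + y * m) + z * m  ≡⟨ lemma′ b y z m ⟩
      (b + z * m) + y * m  ≡⟨ cong (_+ y * m) f ⟩
      (c + w * m) + y * m  ≡⟨ lemma″ c w y m ⟩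
      c + (y + w) * m      ∎)
    where
    open ≡-Reasoning
    lemma : ∀ a x z m → a + (x + z) * m ≡ (a + x * m) + z * m
    lemma = solve-∀
    lemma′ : ∀ b y z m → (b + y * m) + z * m ≡ (b + z * m) + y * m
    lemma′ = solve-∀
    lemma″ : ∀ c w y m → (c + w * m) + y * m ≡ c + (y + w) * m
    lemma″ = solve-∀

  +-mod : ∀ {a b c d} → a ≡ b mod m → c ≡ d mod m → a + c ≡ b + d mod m
  +-mod {a} {b} {c} {d} (x , y , e) (z , w , f) = x + z , y + w , (begin
      a + c + (x + z) * m          ≡⟨ lemma a c x z m ⟩
      (a + x * m) + (c + z * m)    ≡⟨ cong₂ _+_ e f ⟩
      (b + y * m) + (d + w * m)    ≡⟨ lemma b d y w m ⟨
      b + d + (y + w) * m          ∎)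
    where
    open ≡-Reasoning
    lemma : ∀ a c x z m → a + c + (x + z) * m ≡ (a + x * m) + (c + z * m)
    lemma = solve-∀

  *-mod : ∀ {a b c d} → a ≡ b mod m → c ≡ d mod m → a * c ≡ b * d mod m
  *-mod {a} {b} {c} {d} (x , y , e) (z , w , f) =
    x * c + a * z + x * z * m , y * d + b * w + y * w * m , (begin
      a * c + (x * c + a * z + x * z * m) * m  ≡⟨ lemma a c x z m ⟩
      (a + x * m) * (c + z * m)                ≡⟨ cong₂ _*_ e f ⟩
      (b + y * m) * (d + w * m)                ≡⟨ lemma b d y w m ⟨
      b * d + (y * d + b * w + y * w * m) * m  ∎)
    where
    open ≡-Reasoning
    lemma : ∀ a c x z m → a * c + (x * c + a * z + x * z * m) * m ≡ (a + x * m) * (c + z * m)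
    lemma = solve-∀

  +-modˡ : ∀ k {a b} → a ≡ b mod m → k + a ≡ k + b mod m
  +-modˡ k = +-mod (mod-refl {a = k})

  +-modʳ : ∀ k {a b} → a ≡ b mod m → a + k ≡ b + k mod m
  +-modʳ k p = +-mod p (mod-refl {a = k})

  *-modˡ : ∀ k {a b} → a ≡ b mod m → k * a ≡ k * b mod m
  *-modˡ k = *-mod (mod-refl {a = k})

  ^-mod : ∀ {a b} i → a ≡ b mod m → a ^ i ≡ b ^ i mod m
  ^-mod zero    _ = mod-refl
  ^-mod (suc i) p = *-mod p (^-mod i p)

  +-∣-mod : ∀ {a D} → m ∣ D → a + D ≡ a mod m
  +-∣-mod (divides q refl) = 0 , q , +-identityʳ _

  ∣⇒≡0-mod : ∀ {a} → m ∣ a → a ≡ 0 mod m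
  ∣⇒≡0-mod (divides q refl) = 0 , q , +-identityʳ _

  ≡0-mod⇒∣ : ∀ {a} → a ≡ 0 mod m → m ∣ a
  ≡0-mod⇒∣ {a} (x , y , e) =
    ∣m+n∣m⇒∣n (subst (m ∣_) (trans (sym e) (+-comm a (x * m))) (n∣m*n y)) (n∣m*n x)

  ≡-mod-weaken : ∀ {d a b} → d ∣ m → a ≡ b mod m → a ≡ b mod d
  ≡-mod-weaken {d} {a} {b} (divides q refl) (x , y , e) = x * q , y * q , (begin
      a + x * q * d    ≡⟨ lemma a x q d ⟩
      a + x * (q * d)  ≡⟨ e ⟩
      b + y * (q * d)  ≡⟨ lemma b y q d ⟨
      b + y * q * d    ∎)
    where
    open ≡-Reasoning
    lemma : ∀ a x q d → a + x * q * d ≡ a + x * (q * d)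
    lemma = solve-∀

  *-scale-mod : ∀ B {a b} → a ≡ b mod m → B * a ≡ B * b mod (B * m)
  *-scale-mod B {a} {b} (x , y , e) = x , y , (begin
      B * a + x * (B * m)  ≡⟨ lemma B a x m ⟩
      B * (a + x * m)      ≡⟨ cong (B *_) e ⟩
      B * (b + y * m)      ≡⟨ lemma B b y m ⟨
      B * b + y * (B * m)  ∎)
    where
    open ≡-Reasoning
    lemma : ∀ B a x m → B * a + x * (B * m) ≡ B * (a + x * m)
    lemma = solve-∀

  *-cancel-mod : ∀ B .{{_ : NonZero B}} {a b} → a * B ≡ b * B mod (m * B) → a ≡ b mod m
  *-cancel-mod B {a} {b} (x , y , e) = x , y , *-cancelʳ-≡ _ _ B (begin
      (a + x * m) * B      ≡⟨ lemma a x m B ⟩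
      a * B + x * (m * B)  ≡⟨ e ⟩
      b * B + y * (m * B)  ≡⟨ lemma b y m B ⟨
      (b + y * m) * B      ∎)
    where
    open ≡-Reasoning
    lemma : ∀ a x m B → (a + x * m) * B ≡ a * B + x * (m * B)
    lemma = solve-∀


≡-mod-setoid : ℕ → Setoid _ _
≡-mod-setoid m = record
  { _≈_ = λ a b → a ≡ b mod m
  ; isEquivalence = record { refl = mod-refl ; sym = mod-sym ; trans = mod-trans }
  }

module ≡-mod-Reasoning (m : ℕ) = SetoidReasoning (≡-mod-setoid m)

mod-1 : ∀ {a b} → a ≡ b mod 1
mod-1 {a} {b} = b , a , trans (cong (a +_) (*-identityʳ b)) (trans (+-comm a b) (cong (b +_) (sym (*-identityʳ a))))

module _ {m : ℕ} .{{_ : NonZero m}} where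

  %-mod : ∀ a → a % m ≡ a mod m
  %-mod a = a / m , 0 , trans (sym (m≡m%n+[m/n]*n a m)) (sym (+-identityʳ a))

  ≡-mod⇒≡ : ∀ {a b} → a < m → b < m → a ≡ b mod m → a ≡ b
  ≡-mod⇒≡ {a} {b} a<m b<m (x , y , e) = begin
      a                  ≡⟨ m<n⇒m%n≡m a<m ⟨
      a % m              ≡⟨ [m+kn]%n≡m%n a x m ⟨
      (a + x * m) % m    ≡⟨ cong (_% m) e ⟩
      (b + y * m) % m    ≡⟨ [m+kn]%n≡m%n b y m ⟩
      b % m              ≡⟨ m<n⇒m%n≡m b<m ⟩
      b                  ∎
    where open ≡-Reasoning

  ≡-mod⇒%≡ : ∀ {a b} → a ≡ b mod m → a % m ≡ b % m
  ≡-mod⇒%≡ {a} {b} p =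
    ≡-mod⇒≡ (m%n<n a m) (m%n<n b m) (mod-trans (%-mod a) (mod-trans p (mod-sym (%-mod b))))

  ≡-mod⇒%≡< : ∀ {a b} → b < m → a ≡ b mod m → a % m ≡ b
  ≡-mod⇒%≡< {a} b<m p = ≡-mod⇒≡ (m%n<n a m) b<m (mod-trans (%-mod a) p)

  [k*[1%m]+0]%m≡k : ∀ {k} → k < m → (k * (1 % m) + 0) % m ≡ k
  [k*[1%m]+0]%m≡k {k} k<m = ≡-mod⇒%≡< k<m (begin
    k * (1 % m) + 0  ≡⟨ +-identityʳ _ ⟩
    k * (1 % m)      ≈⟨ *-modˡ k (%-mod 1) ⟩
    k * 1            ≡⟨ *-identityʳ k ⟩
    k                ∎)
    where open ≡-mod-Reasoning m

suc-cancel-mod : ∀ {m a b} → suc a ≡ suc b mod m → a ≡ b mod m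
suc-cancel-mod (x , y , e) = x , y , suc-injective e

≡-mod-B*p⇒multiple : ∀ {B p X c} .{{_ : NonZero B}} → X ≡ B * c mod (B * p)
                   → ∃ λ c₀ → (X ≡ B * c₀) × (c₀ ≡ c mod p)
≡-mod-B*p⇒multiple {B} {p} {X} {c} X≡Bc = c₀ , trans X≡c₀B (*-comm c₀ B) , *-cancel-mod B c₀B≡cB
  where
  B∣X : B ∣ X
  B∣X = ≡0-mod⇒∣ (mod-trans (≡-mod-weaken (m∣m*n p) X≡Bc) (∣⇒≡0-mod (m∣m*n c)))
  c₀ : ℕ
  c₀ = quotient B∣X
  X≡c₀B : X ≡ c₀ * B
  X≡c₀B = _∣_.equality B∣X
  c₀B≡cB : c₀ * B ≡ c * B mod (p * B)
  c₀B≡cB = subst (c₀ * B ≡ c * B mod_) (*-comm B p) (subst₂ (_≡_mod (B * p)) X≡c₀B (*-comm B c) X≡Bc)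

-- Bounded quantifiers and counting

T-∧⁺ : ∀ {a b} → T a → T b → T (a ∧ b)
T-∧⁺ ta tb = Equivalence.from Bool.T-∧ (ta , tb)

T-∧⁻ : ∀ {a b} → T (a ∧ b) → T a × T b
T-∧⁻ = Equivalence.to Bool.T-∧

T-⇒ᵇ⁺ : ∀ {a b} → (T a → T b) → T (a ⇒ᵇ b)
T-⇒ᵇ⁺ {true}  f = f _
T-⇒ᵇ⁺ {false} f = _

T-⇒ᵇ⁻ : ∀ {a b} → T (a ⇒ᵇ b) → T a → T b
T-⇒ᵇ⁻ {true} t _ = t

module _ (n : ℕ) (f : ℕ → Bool) where

  allBelow⁺ : (∀ x → x < n → T (f x)) → T (allBelow n f)
  allBelow⁺ h = all⁻ f (All.tabulate λ {x} x∈ → h x (∈-upTo⁻ x∈))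

  allBelow⁻ : T (allBelow n f) → ∀ x → x < n → T (f x)
  allBelow⁻ t x x<n = All.lookup (all⁺ f (upTo n) t) (∈-upTo⁺ x<n)

  anyBelow⁺ : ∀ x → x < n → T (f x) → T (anyBelow n f)
  anyBelow⁺ x x<n fx = any⁺ f (lose (∈-upTo⁺ x<n) fx)

  anyBelow⁻ : T (anyBelow n f) → ∃ λ x → x < n × T (f x)
  anyBelow⁻ t with x , x∈ , fx ← find (any⁻ f (upTo n) t) = x , ∈-upTo⁻ x∈ , fx

  anyBelow-∧⁻ : (g : ℕ → Bool) → T (anyBelow n (λ x → f x ∧ g x)) → ∃ λ x → x < n × T (f x) × T (g x)
  anyBelow-∧⁻ g t with x , x∈ , fgx ← find (any⁻ _ (upTo n) t) = x , ∈-upTo⁻ x∈ , T-∧⁻ {f x} fgx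

countBelow-suc : ∀ n f → countBelow (suc n) f ≡ countBelow n f + (if f n then 1 else 0)
countBelow-suc n f = begin
  length (filterᵇ f (upTo (suc n)))               ≡⟨ cong (length ∘ filterᵇ f) (upTo-∷ʳ n) ⟨
  length (filterᵇ f (upTo n ++ [ n ]))            ≡⟨ cong length (filter-++ (T? ∘ f) (upTo n) [ n ]) ⟩
  length (filterᵇ f (upTo n) ++ filterᵇ f [ n ])  ≡⟨ length-++ (filterᵇ f (upTo n)) ⟩
  countBelow n f + length (filterᵇ f [ n ])       ≡⟨ cong (countBelow n f +_) singleton ⟩
  countBelow n f + (if f n then 1 else 0)         ∎
  where
  open ≡-Reasoning
  singleton : length (filterᵇ f [ n ]) ≡ (if f n then 1 else 0)
  singleton with f n
  ... | true  = refl
  ... | false = refl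

countBelow≡0 : ∀ n f → (∀ x → x < n → ¬ T (f x)) → countBelow n f ≡ 0
countBelow≡0 zero    f _ = refl
countBelow≡0 (suc n) f h rewrite countBelow-suc n f with f n in fn
... | true  = ⊥-elim (h n ≤-refl (subst T (sym fn) _))
... | false = trans (+-identityʳ _) (countBelow≡0 n f (λ x x<n → h x (m<n⇒m<1+n x<n)))

countBelow-+ : ∀ m k f → countBelow (m + k) f ≡ countBelow m f + countBelow k (λ x → f (m + x))
countBelow-+ m zero f = trans (cong (λ z → countBelow z f) (+-identityʳ m)) (sym (+-identityʳ _))
countBelow-+ m (suc k) f
  rewrite +-suc m k | countBelow-suc (m + k) f | countBelow-suc k (λ x → f (m + x)) | countBelow-+ m k f =
  +-assoc (countBelow m f) _ _

countBelow-mono : ∀ n f g → (∀ x → x < n → T (f x) → T (g x)) → countBelow n f ≤ countBelow n g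
countBelow-mono zero    f g h = z≤n
countBelow-mono (suc n) f g h rewrite countBelow-suc n f | countBelow-suc n g =
  +-mono-≤ (countBelow-mono n f g (λ x x<n → h x (m<n⇒m<1+n x<n))) (indicator-mono (h n ≤-refl))
  where
  indicator-mono : ∀ {a b} → (T a → T b) → (if a then 1 else 0) ≤ (if b then 1 else 0)
  indicator-mono {false}         _ = z≤n
  indicator-mono {true} {true}   _ = ≤-refl
  indicator-mono {true} {false}  h = ⊥-elim (h _)

countBelow-cong : ∀ n f g → (∀ x → x < n → T (f x) ⇔ T (g x)) → countBelow n f ≡ countBelow n g
countBelow-cong n f g h = ≤-antisym (countBelow-mono n f g (λ x x<n → Equivalence.to (h x x<n)))
                                    (countBelow-mono n g f (λ x x<n → Equivalence.from (h x x<n)))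

countBelow-extend : ∀ {n m} f → n ≤ m → countBelow n f ≤ countBelow m f
countBelow-extend {n} {m} f n≤m = begin
  countBelow n f                                          ≤⟨ m≤m+n _ _ ⟩
  countBelow n f + countBelow (m ∸ n) (λ x → f (n + x))  ≡⟨ countBelow-+ n (m ∸ n) f ⟨
  countBelow (n + (m ∸ n)) f                              ≡⟨ cong (λ k → countBelow k f) (m+[n∸m]≡n n≤m) ⟩
  countBelow m f                                          ∎
  where open ≤-Reasoning

countBelow-≥1 : ∀ n f a → a < n → T (f a) → 1 ≤ countBelow n f
countBelow-≥1 n f a a<n fa = ≤-trans upToA (countBelow-extend f a<n)
  where
  upToA : 1 ≤ countBelow (suc a) f
  upToA rewrite countBelow-suc a f with f a
  ... | true = m≤n+m 1 _

countBelow-≥2 : ∀ n f a b → a < b → b < n → T (f a) → T (f b) → 2 ≤ countBelow n f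
countBelow-≥2 n f a b a<b b<n fa fb = ≤-trans upToB (countBelow-extend f b<n)
  where
  upToB : 2 ≤ countBelow (suc b) f
  upToB rewrite countBelow-suc b f with f b
  ... | true = subst (2 ≤_) (+-comm 1 _) (s≤s (countBelow-≥1 b f a a<b fa))

countBelow-≤1 : ∀ n f a → (∀ x → x < n → T (f x) → x ≡ a) → countBelow n f ≤ 1
countBelow-≤1 zero    f a h = z≤n
countBelow-≤1 (suc n) f a h rewrite countBelow-suc n f with f n in fn
... | true  = ≤-reflexive (cong (_+ 1) (countBelow≡0 n f below))
  where
  below : ∀ x → x < n → ¬ T (f x)
  below x x<n fx = <-irrefl (trans (h x (m<n⇒m<1+n x<n) fx) (sym (h n ≤-refl (subst T (sym fn) _)))) x<n
... | false = subst (_≤ 1) (sym (+-identityʳ _)) (countBelow-≤1 n f a (λ x x<n → h x (m<n⇒m<1+n x<n)))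

countBelow-≤2 : ∀ n f a b → (∀ x → x < n → T (f x) → x ≡ a ⊎ x ≡ b) → countBelow n f ≤ 2
countBelow-≤2 zero    f a b h = z≤n
countBelow-≤2 (suc n) f a b h rewrite countBelow-suc n f with f n in fn
... | false = subst (_≤ 2) (sym (+-identityʳ _)) (countBelow-≤2 n f a b (λ x x<n → h x (m<n⇒m<1+n x<n)))
... | true with h n ≤-refl (subst T (sym fn) _)
...   | inj₁ refl = +-monoˡ-≤ 1 (countBelow-≤1 n f b λ x x<n fx →
                    [ (λ x≡n → ⊥-elim (<-irrefl x≡n x<n)) , id ]′ (h x (m<n⇒m<1+n x<n) fx))
...   | inj₂ refl = +-monoˡ-≤ 1 (countBelow-≤1 n f a λ x x<n fx →
                    [ id , (λ x≡n → ⊥-elim (<-irrefl x≡n x<n)) ]′ (h x (m<n⇒m<1+n x<n) fx))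

module _ (n : ℕ) (f : ℕ → Bool) (a : ℕ) where
  private
    other : ℕ → Bool
    other x = f x ∧ not (does (x ≟ a))

  countBelow≢1 : a < n → T (f a) → countBelow n f ≢ 1 → ∃ λ x → x < n × T (f x) × x ≢ a
  countBelow≢1 a<n fa count≢1 with anyBelow n other in anyOther
  ... | true  = witness (anyBelow⁻ n other (subst T (sym anyOther) _))
    where
    witness : ∃ (λ x → x < n × T (other x)) → ∃ λ x → x < n × T (f x) × x ≢ a
    witness (x , x<n , t) with fx , x≢ᵇa ← T-∧⁻ {f x} t =
      x , x<n , fx , λ x≡a → subst (T ∘ not) (dec-true (x ≟ a) x≡a) x≢ᵇa
  ... | false = ⊥-elim (count≢1 (≤-antisym (countBelow-≤1 n f a onlyA) (countBelow-≥1 n f a a<n fa)))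
    where
    onlyA : ∀ x → x < n → T (f x) → x ≡ a
    onlyA x x<n fx with x ≟ a
    ... | yes x≡a = x≡a
    ... | no  x≢a = ⊥-elim (subst T anyOther (anyBelow⁺ n other x x<n
                      (subst (λ b → T (f x ∧ not b)) (sym (dec-false (x ≟ a) x≢a)) (T-∧⁺ fx _))))

firstBelow : ∀ n (f : ℕ → Bool) → (∃ λ x → x < n × T (f x) × (∀ y → y < x → ¬ T (f y))) ⊎ (∀ y → y < n → ¬ T (f y))
firstBelow zero    f = inj₂ λ _ ()
firstBelow (suc n) f with firstBelow n f
... | inj₁ (x , x<n , fx , before) = inj₁ (x , m<n⇒m<1+n x<n , fx , before)
... | inj₂ none with f n in fn
...   | true  = inj₁ (n , ≤-refl , subst T (sym fn) _ , none)
...   | false = inj₂ noneUpTo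
  where
  noneUpTo : ∀ y → y < suc n → ¬ T (f y)
  noneUpTo y y<1+n fy with m<1+n⇒m<n∨m≡n y<1+n
  ... | inj₁ y<n  = none y y<n fy
  ... | inj₂ refl = subst T fn fy

countBelow-∧< : ∀ {m n} f → m ≤ n → countBelow n (λ x → f x ∧ (x <ᵇ m)) ≡ countBelow m f
countBelow-∧< {m} {n} f m≤n = begin
  countBelow n f<m                                              ≡⟨ cong (λ k → countBelow k f<m) (m+[n∸m]≡n m≤n) ⟨
  countBelow (m + (n ∸ m)) f<m                                  ≡⟨ countBelow-+ m (n ∸ m) f<m ⟩
  countBelow m f<m + countBelow (n ∸ m) (λ x → f<m (m + x))     ≡⟨ cong₂ _+_ below above ⟩
  countBelow m f + 0                                            ≡⟨ +-identityʳ _ ⟩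
  countBelow m f                                                ∎
  where
  open ≡-Reasoning
  f<m : ℕ → Bool
  f<m x = f x ∧ (x <ᵇ m)
  below : countBelow m f<m ≡ countBelow m f
  below = countBelow-cong m f<m f λ x x<m →
    mk⇔ (proj₁ ∘ T-∧⁻ {f x}) (λ fx → T-∧⁺ fx (<⇒<ᵇ x<m))
  above : countBelow (n ∸ m) (λ x → f<m (m + x)) ≡ 0
  above = countBelow≡0 (n ∸ m) _ λ x _ t →
    <⇒≱ (<ᵇ⇒< (m + x) m (proj₂ (T-∧⁻ {f (m + x)} t))) (m≤m+n m x)

countBelow-multiples : ∀ d .{{_ : NonZero d}} s → countBelow (s * d) (λ x → isYes (d ∣? x)) ≡ s
countBelow-multiples d zero    = refl
countBelow-multiples d@(suc d′) (suc s) = begin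
  countBelow (d + s * d) d∣                                   ≡⟨ cong (λ k → countBelow k d∣) (+-comm d (s * d)) ⟩
  countBelow (s * d + d) d∣                                   ≡⟨ countBelow-+ (s * d) d d∣ ⟩
  countBelow (s * d) d∣ + countBelow d (λ x → d∣ (s * d + x)) ≡⟨ cong₂ _+_ (countBelow-multiples d s) nextBlock ⟩
  s + 1                                                       ≡⟨ +-comm s 1 ⟩
  suc s                                                       ∎
  where
  open ≡-Reasoning
  d∣ : ℕ → Bool
  d∣ x = isYes (d ∣? x)
  first : countBelow 1 (λ x → d∣ (s * d + x)) ≡ 1
  first = trans (countBelow-suc 0 (λ x → d∣ (s * d + x))) $ cong (λ b → if b then 1 else 0)
    (Equivalence.to Bool.T-≡ (fromWitness {a? = d ∣? (s * d + 0)} (subst (d ∣_) (sym (+-identityʳ _)) (n∣m*n s))))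
  rest : countBelow d′ (λ x → d∣ (s * d + suc x)) ≡ 0
  rest = countBelow≡0 d′ _ λ x x<d′ t →
    <⇒≱ (s≤s x<d′) (∣⇒≤ (∣m+n∣m⇒∣n (toWitness {a? = d ∣? (s * d + suc x)} t) (n∣m*n s)))
  nextBlock : countBelow d (λ x → d∣ (s * d + x)) ≡ 1
  nextBlock = trans (countBelow-+ 1 d′ (λ x → d∣ (s * d + x))) (cong₂ _+_ first rest)

-- Subgroups of ℤ/nℤ and the order of a section

module _ {n : ℕ} .{{_ : NonZero n}} where

  record Multiples (H : Subset) : Set where
    field
      base   : ℕ
      base>0 : 0 < base
      base∣n : base ∣ n
      ∈⇒∣    : ∀ {x} → T (H x) → base ∣ x
      ∣⇒∈    : ∀ {x} → x < n → base ∣ x → T (H x)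

  -- c is the least positive element of H, or n if there is none; c % n covers both cases.
  module _ {H : Subset} (sg : IsSubgroup n H) {c : ℕ} .{{_ : NonZero c}}
           (c∈ : T (H (c % n))) (minimal : ∀ y → 0 < y → y < c → ¬ T (H y)) (c≤n : c ≤ n) where

    open IsSubgroup sg

    multiple∈ : ∀ j → T (H ((j * c) % n))
    multiple∈ zero    = subst (T ∘ H) (sym (m<n⇒m%n≡m (>-nonZero⁻¹ n))) zero∈
    multiple∈ (suc j) = subst (T ∘ H) (sym (%-distribˡ-+ c (j * c) n)) (addClos _ _ c∈ (multiple∈ j))

    -- x % c = x + (n - (x / c) c) in ℤ/nℤ, a sum of elements of H.
    %-base∈ : ∀ x → T (H (x % n)) → T (H (x % c))
    %-base∈ x x∈ = subst (T ∘ H) (≡-mod⇒%≡< r<n sum≡r) (addClos _ _ x∈ (negClos a (multiple∈ q)))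
      where
      q : ℕ
      q = x / c
      r : ℕ
      r = x % c
      a : ℕ
      a = (q * c) % n
      r<n : r < n
      r<n = <-≤-trans (m%n<n x c) c≤n
      sum≡r : x % n + (n ∸ a) % n ≡ r mod n
      sum≡r = begin
        x % n + (n ∸ a) % n  ≈⟨ +-mod (%-mod x) (%-mod (n ∸ a)) ⟩
        x + (n ∸ a)          ≡⟨ cong (_+ (n ∸ a)) (m≡m%n+[m/n]*n x c) ⟩
        r + q * c + (n ∸ a)  ≈⟨ +-modʳ (n ∸ a) (+-modˡ r (%-mod (q * c))) ⟨
        r + a + (n ∸ a)      ≡⟨ +-assoc r a (n ∸ a) ⟩
        r + (a + (n ∸ a))    ≡⟨ cong (r +_) (m+[n∸m]≡n (<⇒≤ (m%n<n (q * c) n))) ⟩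
        r + n                ≈⟨ +-∣-mod ∣-refl ⟩
        r                    ∎
        where open ≡-mod-Reasoning n

    %n∈⇒base∣ : ∀ x → T (H (x % n)) → c ∣ x
    %n∈⇒base∣ x x∈ = m%n≡0⇒n∣m x c remainder≡0
      where
      remainder≡0 : x % c ≡ 0
      remainder≡0 with x % c ≟ 0
      ... | yes r≡0 = r≡0
      ... | no  r≢0 = ⊥-elim (minimal (x % c) (n≢0⇒n>0 r≢0) (m%n<n x c) (%-base∈ x x∈))

    leastPositive⇒multiples : Multiples H
    leastPositive⇒multiples = record
      { base   = c
      ; base>0 = >-nonZero⁻¹ c
      ; base∣n = %n∈⇒base∣ n (subst (T ∘ H) (sym (n%n≡0 n)) zero∈)
      ; ∈⇒∣    = λ {x} x∈ → %n∈⇒base∣ x (subst (T ∘ H) (sym (m<n⇒m%n≡m (inG x x∈))) x∈)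
      ; ∣⇒∈    = λ { {x} x<n (divides q refl) → subst (T ∘ H) (m<n⇒m%n≡m x<n) (multiple∈ q) }
      }

  subgroup⇒multiples : ∀ {H} → IsSubgroup n H → Multiples H
  subgroup⇒multiples {H} sg with firstBelow n (λ x → (0 <ᵇ x) ∧ H x)
  ... | inj₁ (c , c<n , t , before) =
    leastPositive⇒multiples sg {{>-nonZero c>0}} c∈ minimal (<⇒≤ c<n)
    where
    c>0 : 0 < c
    c>0 = <ᵇ⇒< 0 c (proj₁ (T-∧⁻ {0 <ᵇ c} t))
    c∈ : T (H (c % n))
    c∈ = subst (T ∘ H) (sym (m<n⇒m%n≡m c<n)) (proj₂ (T-∧⁻ {0 <ᵇ c} t))
    minimal : ∀ y → 0 < y → y < c → ¬ T (H y)
    minimal y y>0 y<c y∈ = before y y<c (T-∧⁺ (<⇒<ᵇ y>0) y∈)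
  ... | inj₂ none =
    leastPositive⇒multiples sg (subst (T ∘ H) (sym (n%n≡0 n)) (IsSubgroup.zero∈ sg)) minimal ≤-refl
    where
    minimal : ∀ y → 0 < y → y < n → ¬ T (H y)
    minimal y y>0 y<n y∈ = none y y<n (T-∧⁺ (<⇒<ᵇ y>0) y∈)

+-multiple-≤ : ∀ {c l n} → c ∣ l → c ∣ n → l < n → l + c ≤ n
+-multiple-≤ {c} (divides a refl) (divides b refl) a*c<b*c =
  subst (_≤ b * c) (+-comm c (a * c)) (*-monoˡ-≤ c (*-cancelʳ-< _ a b a*c<b*c))

module _ {n : ℕ} .{{_ : NonZero n}} {L : Subset} (mL : Multiples L) where

  open Multiples mL renaming (base to cL; base∣n to cL∣n; base>0 to cL>0)

  <base⇒canonical : ∀ {x} → x < cL → T (isCanonRep n L x)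
  <base⇒canonical {x} x<cL = allBelow⁺ n _ λ l l<n → T-⇒ᵇ⁺ λ l∈ → ≤⇒≤ᵇ (x≤[x+l]%n l<n l∈)
    where
    x≤[x+l]%n : ∀ {l} → l < n → T (L l) → x ≤ (x + l) % n
    x≤[x+l]%n {l} l<n l∈ = subst (x ≤_) (sym (m<n⇒m%n≡m x+l<n)) (m≤m+n x l)
      where
      x+l<n : x + l < n
      x+l<n = <-≤-trans (+-monoˡ-< l x<cL) (subst (_≤ n) (+-comm l cL) (+-multiple-≤ (∈⇒∣ l∈) cL∣n l<n))

  -- Adding n - cL ∈ L to any x ≥ cL lands strictly below x.
  canonical⇒<base : ∀ {x} → x < n → T (isCanonRep n L x) → x < cL
  canonical⇒<base {x} x<n canonical with x <? cL
  ... | yes x<cL = x<cL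
  ... | no  x≮cL = ⊥-elim (<⇒≱ (∸-monoʳ-< cL>0 cL≤x) (subst (x ≤_) shifted (≤ᵇ⇒≤ x _ x≤shifted)))
    where
    cL≤x : cL ≤ x
    cL≤x = ≮⇒≥ x≮cL
    cL≤n : cL ≤ n
    cL≤n = ∣⇒≤ cL∣n
    l : ℕ
    l = n ∸ cL
    l<n : l < n
    l<n = ∸-monoʳ-< cL>0 cL≤n
    cL∣l : cL ∣ l
    cL∣l = ∣m+n∣m⇒∣n (subst (cL ∣_) (sym (m+[n∸m]≡n cL≤n)) cL∣n) ∣-refl
    x≤shifted : T (x ≤ᵇ (x + l) % n)
    x≤shifted = T-⇒ᵇ⁻ (allBelow⁻ n _ canonical l l<n) (∣⇒∈ l<n cL∣l)
    shifted : (x + l) % n ≡ x ∸ cL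
    shifted = ≡-mod⇒%≡< (≤-<-trans (m∸n≤m x cL) x<n) (begin
      x + (n ∸ cL)              ≡⟨ cong (_+ (n ∸ cL)) (m∸n+n≡m cL≤x) ⟨
      x ∸ cL + cL + (n ∸ cL)    ≡⟨ +-assoc (x ∸ cL) cL _ ⟩
      x ∸ cL + (cL + (n ∸ cL))  ≡⟨ cong (x ∸ cL +_) (m+[n∸m]≡n cL≤n) ⟩
      x ∸ cL + n                ≈⟨ +-∣-mod ∣-refl ⟩
      x ∸ cL                    ∎)
      where open ≡-mod-Reasoning n

module _ {n : ℕ} .{{_ : NonZero n}} {U L : Subset} (mU : Multiples U) (mL : Multiples L) where

  open Multiples mU using () renaming (base to cU; base>0 to cU>0)
  open Multiples mL using () renaming (base to cL; base∣n to cL∣n)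

  secOrder≡ : ∀ {s} → cL ≡ s * cU → secOrder n U L ≡ s
  secOrder≡ {s} cL≡s*cU = begin
    countBelow n (λ g → U g ∧ isCanonRep n L g)    ≡⟨ countBelow-cong n _ _ (λ g → reindex {g}) ⟩
    countBelow n (λ g → cU∣ g ∧ (g <ᵇ cL))         ≡⟨ countBelow-∧< cU∣ (∣⇒≤ cL∣n) ⟩
    countBelow cL cU∣                              ≡⟨ cong (λ k → countBelow k cU∣) cL≡s*cU ⟩
    countBelow (s * cU) cU∣                        ≡⟨ countBelow-multiples cU {{>-nonZero cU>0}} s ⟩
    s                                              ∎
    where
    open ≡-Reasoning
    cU∣ : ℕ → Bool
    cU∣ g = isYes (cU ∣? g)
    reindex : ∀ {g} → g < n → T (U g ∧ isCanonRep n L g) ⇔ T (cU∣ g ∧ (g <ᵇ cL))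
    reindex {g} g<n = mk⇔
      (λ t → let g∈U , canonical = T-∧⁻ {U g} t in
        T-∧⁺ (fromWitness (Multiples.∈⇒∣ mU g∈U)) (<⇒<ᵇ (canonical⇒<base mL g<n canonical)))
      (λ t → let cU∣g , g<cL = T-∧⁻ {cU∣ g} t in
        T-∧⁺ (Multiples.∣⇒∈ mU g<n (toWitness cU∣g)) (<base⇒canonical mL (<ᵇ⇒< g cL g<cL)))

-- Primes, binomials and divisibility

prime⇒1< : ∀ {p} → Prime p → 1 < p
prime⇒1< {p} p-prime = nonTrivial⇒n>1 p {{prime⇒nonTrivial p-prime}}

∃prime∣ : ∀ {m} → 1 < m → ∃ λ q → Prime q × q ∣ m
∃prime∣ {m} 1<m = firstFactor (PrimeFactorisation.factors f)
  (PrimeFactorisation.isFactorisation f) (PrimeFactorisation.factorsPrime f)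
  where
  instance
    m≢0 : NonZero m
    m≢0 = >-nonZero (<-trans z<s 1<m)
  f : PrimeFactorisation m
  f = factorise m
  firstFactor : ∀ qs → m ≡ product qs → All Prime qs → ∃ λ q → Prime q × q ∣ m
  firstFactor []       m≡1 _           = ⊥-elim (<-irrefl (sym m≡1) 1<m)
  firstFactor (q ∷ qs) m≡qΠ (q-prime ∷ _) = q , q-prime , subst (q ∣_) (sym m≡qΠ) (m∣m*n (product qs))

prime∤⇒coprime : ∀ {p c} → Prime p → ¬ p ∣ c → Coprime p c
prime∤⇒coprime p-prime p∤c (i∣p , i∣c) with prime⇒irreducible p-prime i∣p
... | inj₁ i≡1 = i≡1
... | inj₂ refl = ⊥-elim (p∤c i∣c)

prime∣prime⇒≡ : ∀ {p q} → Prime p → Prime q → q ∣ p → q ≡ p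
prime∣prime⇒≡ p-prime q-prime q∣p with prime⇒irreducible p-prime q∣p
... | inj₁ refl = ⊥-elim (<-irrefl refl (prime⇒1< q-prime))
... | inj₂ q≡p  = q≡p

bézout⇒≡-mod : ∀ {d m n} .{{_ : NonZero n}} → Bézout.Identity d m n → ∃ λ a → d ≡ a * m mod n
bézout⇒≡-mod {d} {m} {n} (Bézout.+- x y eq) = x , y , 0 , trans eq (sym (+-identityʳ _))
bézout⇒≡-mod {d} {m} {n@(suc n′)} (Bézout.-+ x y eq) = n′ * x , x * m , y , (begin
  d + x * m * suc n′        ≡⟨ lemma d x m n′ ⟩
  d + x * m + n′ * x * m    ≡⟨ cong (_+ n′ * x * m) eq ⟩
  y * suc n′ + n′ * x * m   ≡⟨ +-comm (y * suc n′) _ ⟩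
  n′ * x * m + y * suc n′   ∎)
  where
  open ≡-Reasoning
  lemma : ∀ d x m n′ → d + x * m * suc n′ ≡ d + x * m + n′ * x * m
  lemma = solve-∀

inverse-mod-prime : ∀ {p c} → Prime p → ¬ p ∣ c → ∃ λ v → v * c ≡ 1 mod p
inverse-mod-prime {p} p-prime p∤c with v , 1≡vc ← bézout⇒≡-mod {{prime⇒nonZero p-prime}}
  (coprime-Bézout (Coprime.sym (prime∤⇒coprime p-prime p∤c))) = v , mod-sym 1≡vc

-- triangle i = i (i - 1) / 2, the coefficient of X² in (1 + X)^i.
triangle : ℕ → ℕ
triangle zero    = 0
triangle (suc i) = triangle i + i

triangle-suc*2 : ∀ m → triangle (suc m) * 2 ≡ suc m * m
triangle-suc*2 zero    = refl
triangle-suc*2 (suc m) = begin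
  (triangle (suc m) + suc m) * 2       ≡⟨ *-distribʳ-+ 2 (triangle (suc m)) (suc m) ⟩
  triangle (suc m) * 2 + suc m * 2     ≡⟨ cong (_+ suc m * 2) (triangle-suc*2 m) ⟩
  suc m * m + suc m * 2                ≡⟨ lemma m ⟩
  suc (suc m) * suc m                  ∎
  where
  open ≡-Reasoning
  lemma : ∀ m → suc m * m + suc m * 2 ≡ suc (suc m) * suc m
  lemma = solve-∀

oddPrime∣triangle : ∀ {p} → Prime p → p ≢ 2 → p ∣ triangle p
oddPrime∣triangle {suc m} p-prime p≢2
  with euclidsLemma (triangle (suc m)) 2 p-prime (subst (suc m ∣_) (sym (triangle-suc*2 m)) (m∣m*n m))
... | inj₁ p∣triangle = p∣triangle
... | inj₂ p∣2        = ⊥-elim (p≢2 (≤-antisym (∣⇒≤ p∣2) (prime⇒1< p-prime)))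

binomial : ∀ X i → ∃ λ R → (1 + X) ^ i ≡ 1 + i * X + triangle i * (X * X) + R * (X * X * X)
binomial X zero    = 0 , refl
binomial X (suc i) with R , expansion ← binomial X i =
  R + triangle i + R * X , trans (cong ((1 + X) *_) expansion) (lemma X i (triangle i) R)
  where
  lemma : ∀ X i T R → (1 + X) * (1 + i * X + T * (X * X) + R * (X * X * X))
                    ≡ 1 + suc i * X + (T + i) * (X * X) + (R + T + R * X) * (X * X * X)
  lemma = solve-∀

1+X^i≡1+iX : ∀ {M} X i → M ∣ triangle i * (X * X) → M ∣ X * X * X → (1 + X) ^ i ≡ 1 + i * X mod M
1+X^i≡1+iX {M} X i M∣X² M∣X³ with R , expansion ← binomial X i = begin
  (1 + X) ^ i                                                ≡⟨ expansion ⟩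
  1 + i * X + triangle i * (X * X) + R * (X * X * X)         ≈⟨ +-∣-mod (∣n⇒∣m*n R M∣X³) ⟩
  1 + i * X + triangle i * (X * X)                           ≈⟨ +-∣-mod M∣X² ⟩
  1 + i * X                                                  ∎
  where open ≡-mod-Reasoning M

even⊎odd : ∀ m → 2 ∣ m ⊎ 2 ∣ suc m
even⊎odd zero    = inj₁ (divides 0 refl)
even⊎odd (suc m) with even⊎odd m
... | inj₁ (divides q m≡2q) = inj₂ (divides (suc q) (cong (2 +_) m≡2q))
... | inj₂ 2∣1+m            = inj₁ 2∣1+m

2∣m⇒2∤1+m : ∀ {m} → 2 ∣ m → ¬ 2 ∣ suc m
2∣m⇒2∤1+m 2∣m 2∣1+m with ∣⇒≤ (∣m+n∣m⇒∣n (subst (2 ∣_) (+-comm 1 _) 2∣1+m) 2∣m)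
... | s≤s ()

≥3⇒oddPrime∣⊎4∣ : ∀ e → 3 ≤ e → (∃ λ p → Prime p × p ≢ 2 × p ∣ e) ⊎ 4 ∣ e
≥3⇒oddPrime∣⊎4∣ e 3≤e with even⊎odd e
... | inj₂ 2∣1+e with q , q-prime , q∣e ← ∃prime∣ (<-trans (s≤s (s≤s z≤n)) 3≤e) =
  inj₁ (q , q-prime , (λ { refl → 2∣m⇒2∤1+m q∣e 2∣1+e }) , q∣e)
... | inj₁ (divides e′ refl) with even⊎odd e′
...   | inj₁ (divides e″ refl) = inj₂ (divides e″ (lemma e″))
  where
  lemma : ∀ e″ → e″ * 2 * 2 ≡ e″ * 4
  lemma = solve-∀
...   | inj₂ 2∣1+e′ with q , q-prime , q∣e′ ← ∃prime∣ (*-cancelʳ-< 2 1 e′ 3≤e) =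
  inj₁ (q , q-prime , (λ { refl → 2∣m⇒2∤1+m q∣e′ 2∣1+e′ }) , ∣m⇒∣m*n 2 q∣e′)

n∣2*m⇒m≡0⊎2*m≡n : ∀ {m n} → m < n → n ∣ 2 * m → m ≡ 0 ⊎ 2 * m ≡ n
n∣2*m⇒m≡0⊎2*m≡n {m} {n} m<n (divides zero 2m≡0) = inj₁ (m*n≡0⇒m≡0 m 2 (trans (*-comm m 2) 2m≡0))
n∣2*m⇒m≡0⊎2*m≡n {m} {n} m<n (divides 1 2m≡n) = inj₂ (trans 2m≡n (+-identityʳ n))
n∣2*m⇒m≡0⊎2*m≡n {m} {n} m<n (divides (suc (suc a)) 2m≡[2+a]n) =
  ⊥-elim (<⇒≱ (subst (_< 2 * n) 2m≡[2+a]n (*-monoʳ-< 2 m<n)) (*-monoˡ-≤ n {2} {suc (suc a)} (s≤s (s≤s z≤n))))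

B*p*p∣[Bc]³ : ∀ {B p} c → p ∣ B → B * p * p ∣ B * c * (B * c) * (B * c)
B*p*p∣[Bc]³ {B} {p} c p∣B =
  subst (B * p * p ∣_) (lemma B c) (∣m⇒∣m*n (c * c * c) (*-pres-∣ (*-pres-∣ (∣-refl {B}) p∣B) p∣B))
  where
  lemma : ∀ B c → B * B * B * (c * c * c) ≡ B * c * (B * c) * (B * c)
  lemma = solve-∀

oddPrime⇒B*p*p∣triangle[Bc]² : ∀ {B p} c → Prime p → p ≢ 2 → p ∣ B
                              → B * p * p ∣ triangle p * (B * c * (B * c))
oddPrime⇒B*p*p∣triangle[Bc]² {B} {p} c p-prime p≢2 p∣B =
  subst (B * p * p ∣_) (lemma B (triangle p) c)
    (∣m⇒∣m*n (c * c) (*-pres-∣ (*-pres-∣ (∣-refl {B}) p∣B) (oddPrime∣triangle p-prime p≢2)))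
  where
  lemma : ∀ B T c → B * B * T * (c * c) ≡ T * (B * c * (B * c))
  lemma = solve-∀

4∣B⇒B*2*2∣triangle[Bc]² : ∀ {B} c → 4 ∣ B → B * 2 * 2 ∣ triangle 2 * (B * c * (B * c))
4∣B⇒B*2*2∣triangle[Bc]² {B} c 4∣B =
  subst₂ _∣_ (sym (*-assoc B 2 2)) (lemma B c) (∣m⇒∣m*n (c * c) (*-pres-∣ (∣-refl {B}) 4∣B))
  where
  lemma : ∀ B c → B * B * (c * c) ≡ 1 * (B * c * (B * c))
  lemma = solve-∀

distinctPrimes∣⇒*∣ : ∀ {B p q} → Prime p → Prime q → q ≢ p → p ∣ B → q ∣ B → q * p ∣ B
distinctPrimes∣⇒*∣ {p = p} {q} p-prime q-prime q≢p p∣B (divides b refl)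
  with euclidsLemma b q p-prime p∣B
... | inj₂ p∣q = ⊥-elim (q≢p (sym (prime∣prime⇒≡ q-prime p-prime p∣q)))
... | inj₁ (divides b′ refl) = divides b′ (lemma b′ p q)
  where
  lemma : ∀ b′ p q → b′ * p * q ≡ b′ * (q * p)
  lemma = solve-∀

q*p∣B⇒B*q*p∣[Bc]² : ∀ {B p q} c → q * p ∣ B → B * q * p ∣ B * c * (B * c)
q*p∣B⇒B*q*p∣[Bc]² {B} {p} {q} c qp∣B =
  subst₂ _∣_ (sym (*-assoc B q p)) (lemma B c) (∣m⇒∣m*n (c * c) (*-pres-∣ (∣-refl {B}) qp∣B))
  where
  lemma : ∀ B c → B * B * (c * c) ≡ B * c * (B * c)
  lemma = solve-∀

-- Basic sets and radicals

module _ {n : ℕ} .{{_ : NonZero n}} where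

  basicPre⁺ : ∀ {K L u k l} → k < n → l < n → T (K k) → T (L l) → T (basicPre n K L u ((k * u + l) % n))
  basicPre⁺ {K} {L} {u} {k} {l} k<n l<n k∈K l∈L =
    anyBelow⁺ n _ k k<n (T-∧⁺ k∈K (anyBelow⁺ n _ l l<n (T-∧⁺ l∈L (≡⇒≡ᵇ ((k * u + l) % n) _ refl))))

  basicPre⁻ : ∀ {K L u x} → T (basicPre n K L u x)
            → ∃₂ λ k l → T (K k) × T (L l) × (k * u + l) % n ≡ x
  basicPre⁻ {K} {L} {u} {x} x∈Y
    with k , _ , k∈K , some-l ← anyBelow-∧⁻ n K (λ k → anyBelow n (λ l → L l ∧ ((k * u + l) % n ≡ᵇ x))) x∈Y
    with l , _ , l∈L , sum≡ᵇx ← anyBelow-∧⁻ n L (λ l → (k * u + l) % n ≡ᵇ x) some-l = k , l , k∈K , l∈L , ≡ᵇ⇒≡ _ x sum≡ᵇx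

  stabilises⁻ : ∀ {Y g x} → T (stabilises n Y g) → x < n → T (Y x) → T (Y ((g + x) % n))
  stabilises⁻ {Y} {g} {x} stable x<n x∈Y =
    proj₁ (T-∧⁻ {Y ((g + x) % n)} (T-⇒ᵇ⁻ (allBelow⁻ n _ stable x x<n) x∈Y))

  stabilises⁺ : ∀ {Y g} → (∀ x → x < n → T (Y x) → T (Y ((g + x) % n)))
              → (∀ x → x < n → T (Y x) → ∃ λ y → y < n × T (Y y) × (g + y) % n ≡ x)
              → T (stabilises n Y g)
  stabilises⁺ {Y} {g} forward backward = allBelow⁺ n _ λ x x<n → T-⇒ᵇ⁺ λ x∈Y →
    let y , y<n , y∈Y , g+y≡x = backward x x<n x∈Y
    in T-∧⁺ (forward x x<n x∈Y) (anyBelow⁺ n _ y y<n (T-∧⁺ y∈Y (≡⇒≡ᵇ _ x g+y≡x)))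

  isGenerator⁻ : ∀ {U L u v} → T (isGenerator n U L u) → v < n → T (U v)
               → ∃₂ λ m l → T (L l) × (m * u + l) % n ≡ v
  isGenerator⁻ {U} {L} {u} {v} generator v<n v∈U
    with m , _ , some-l ← anyBelow⁻ n _ (T-⇒ᵇ⁻ (allBelow⁻ n _ generator v v<n) v∈U)
    with l , _ , l∈L , sum≡ᵇv ← anyBelow-∧⁻ n L (λ l → (m * u + l) % n ≡ᵇ v) some-l = m , l , l∈L , ≡ᵇ⇒≡ _ v sum≡ᵇv

module _ (n : ℕ) .{{_ : NonZero n}} (K : Subset) where

  IsPeriod : ℕ → Set
  IsPeriod g = (∀ k → T (K k) → T (K ((g + k) % n)))
             × (∀ k → T (K k) → ∃ λ y → T (K y) × (g + y) % n ≡ k)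

  TrivialRadical : Set
  TrivialRadical = ∀ g → 0 < g → g < n → ¬ IsPeriod g

  OneCoset : ℕ → ℕ → Set
  OneCoset M x = ∀ t → ∃ λ k → T (K k) × k ≡ 1 + t * x mod M

  ExactLevel : ℕ → ℕ → Set
  ExactLevel B p = ∃₂ λ y c → T (K y) × ¬ p ∣ c × y ≡ 1 + B * c mod (B * p)

module _ {n : ℕ} .{{_ : NonZero n}} {K : Subset} (aut : IsAutSubgroup n K) where

  open IsAutSubgroup aut

  ∈K⇒∤ : ∀ {k p} → T (K k) → 1 < p → p ∣ n → ¬ p ∣ k
  ∈K⇒∤ k∈K 1<p p∣n p∣k = <-irrefl (sym (proj₂ (units _ k∈K) (p∣k , p∣n))) 1<p

  ^-∈K : ∀ {y} → T (K y) → ∀ i → T (K ((y ^ i) % n))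
  ^-∈K     y∈K zero    = one
  ^-∈K {y} y∈K (suc i) =
    subst (T ∘ K) (≡-mod⇒%≡ (*-modˡ y (%-mod (y ^ i)))) (mulClos y _ y∈K (^-∈K y∈K i))

  0-isPeriod : IsPeriod n K 0
  0-isPeriod = (λ k k∈K → subst (T ∘ K) (sym (%0+k k∈K)) k∈K) , (λ k k∈K → k , k∈K , %0+k k∈K)
    where
    %0+k : ∀ {k} → T (K k) → (0 + k) % n ≡ k
    %0+k k∈K = m<n⇒m%n≡m (proj₁ (units _ k∈K))

  basicSetOf1 : Subset
  basicSetOf1 = basicPre n K (trivialG n) (1 % n)

  basicSetOf1⊆K : ∀ {x} → T (basicSetOf1 x) → T (K x)
  basicSetOf1⊆K {x} x∈ with k , l , k∈K , l≡ᵇ0 , k+l≡x ← basicPre⁻ x∈ with refl ← ≡ᵇ⇒≡ l 0 l≡ᵇ0 =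
    subst (T ∘ K) (trans (sym ([k*[1%m]+0]%m≡k (proj₁ (units k k∈K)))) k+l≡x) k∈K

  K⊆basicSetOf1 : ∀ {x} → T (K x) → T (basicSetOf1 x)
  K⊆basicSetOf1 {x} x∈K = subst (T ∘ basicSetOf1) ([k*[1%m]+0]%m≡k x<n) (basicPre⁺ x<n (>-nonZero⁻¹ n) x∈K _)
    where
    x<n : x < n
    x<n = proj₁ (units x x∈K)

  isPeriod⇒radical : ∀ {g} → g < n → IsPeriod n K g
                   → T (wholeG n g ∧ isCanonRep n (trivialG n) g ∧ stabilises n basicSetOf1 g)
  isPeriod⇒radical {g} g<n (g+K⊆K , K⊆g+K) = T-∧⁺ (<⇒<ᵇ g<n) (T-∧⁺ canonical stable)
    where
    canonical : T (isCanonRep n (trivialG n) g)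
    canonical = allBelow⁺ n _ λ l _ → T-⇒ᵇ⁺ λ l≡ᵇ0 → ≤⇒≤ᵇ (≤-reflexive (sym (g+0 (≡ᵇ⇒≡ l 0 l≡ᵇ0))))
      where
      g+0 : ∀ {l} → l ≡ 0 → (g + l) % n ≡ g
      g+0 refl = ≡-mod⇒%≡< g<n (mod-reflexive (+-identityʳ g))
    stable : T (stabilises n basicSetOf1 g)
    stable = stabilises⁺ (λ x _ x∈ → K⊆basicSetOf1 (g+K⊆K x (basicSetOf1⊆K x∈))) λ x _ x∈ →
      let y , y∈K , g+y≡x = K⊆g+K x (basicSetOf1⊆K x∈) in y , proj₁ (units y y∈K) , K⊆basicSetOf1 y∈K , g+y≡x

  radCount≡1⇒trivialRadical : radCount n K (wholeG n) (trivialG n) (1 % n) ≡ 1 → TrivialRadical n K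
  radCount≡1⇒trivialRadical radCount≡1 g g>0 g<n g-period = <-irrefl (sym radCount≡1)
    (countBelow-≥2 n _ 0 g g>0 g<n (isPeriod⇒radical (>-nonZero⁻¹ n) 0-isPeriod) (isPeriod⇒radical g<n g-period))

  oneCoset-multiple : ∀ {M x y} a → y ≡ a * x mod M → OneCoset n K M x → OneCoset n K M y
  oneCoset-multiple {M} {x} {y} a y≡ax cosetX t with k , k∈K , k≡ ← cosetX (t * a) =
    k , k∈K , (begin
      k                ≈⟨ k≡ ⟩
      1 + t * a * x    ≡⟨ cong suc (*-assoc t a x) ⟩
      1 + t * (a * x)  ≈⟨ +-modˡ 1 (*-modˡ t y≡ax) ⟨
      1 + t * y        ∎)
    where open ≡-mod-Reasoning M

  module _ {B p : ℕ} (p-prime : Prime p) (n≡Bp : n ≡ B * p) where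

    private
      p∣n : p ∣ n
      p∣n = divides B n≡Bp

      ≡-mod-p⇒≡-mod-n : ∀ {a b} → a ≡ b mod p → B * a ≡ B * b mod n
      ≡-mod-p⇒≡-mod-n {a} {b} a≡b = subst (B * a ≡ B * b mod_) (sym n≡Bp) (*-scale-mod B a≡b)

      p-1 : ℕ
      p-1 = p ∸ 1

      1+[p-1]≡p : 1 + p-1 ≡ p
      1+[p-1]≡p = m+[n∸m]≡n (<⇒≤ (prime⇒1< p-prime))

      inverse : ∀ {k} → T (K k) → ∃ λ w → w * k ≡ 1 mod p
      inverse k∈K = inverse-mod-prime p-prime (∈K⇒∤ k∈K (prime⇒1< p-prime) p∣n)

    -- With w k ≡ 1 (mod p): B + k ≡ k (1 + w B) and k ≡ B + k (1 + (p - 1) w B) modulo n = B p.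
    oneCoset⇒B+K⊆K : OneCoset n K n B → ∀ k → T (K k) → T (K ((B + k) % n))
    oneCoset⇒B+K⊆K cosetB k k∈K with w , wk≡1 ← inverse k∈K with k₁ , k₁∈K , k₁≡ ← cosetB w =
      subst (T ∘ K) (≡-mod⇒%≡ kk₁≡B+k) (mulClos k k₁ k∈K k₁∈K)
      where
      kk₁≡B+k : k * k₁ ≡ B + k mod n
      kk₁≡B+k = begin
        k * k₁               ≈⟨ *-modˡ k k₁≡ ⟩
        k * (1 + w * B)      ≡⟨ lemma k w B ⟩
        k + B * (w * k)      ≈⟨ +-modˡ k (≡-mod-p⇒≡-mod-n wk≡1) ⟩
        k + B * 1            ≡⟨ lemma′ k B ⟩
        B + k                ∎
        where
        open ≡-mod-Reasoning n
        lemma : ∀ k w B → k * (1 + w * B) ≡ k + B * (w * k)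
        lemma = solve-∀
        lemma′ : ∀ k B → k + B * 1 ≡ B + k
        lemma′ = solve-∀

    oneCoset⇒K⊆B+K : OneCoset n K n B → ∀ k → T (K k) → ∃ λ y → T (K y) × (B + y) % n ≡ k
    oneCoset⇒K⊆B+K cosetB k k∈K with w , wk≡1 ← inverse k∈K with k₂ , k₂∈K , k₂≡ ← cosetB (p-1 * w) =
      (k * k₂) % n , mulClos k k₂ k∈K k₂∈K , ≡-mod⇒%≡< (proj₁ (units k k∈K)) B+kk₂≡k
      where
      B+kk₂≡k : B + (k * k₂) % n ≡ k mod n
      B+kk₂≡k = begin
        B + (k * k₂) % n               ≈⟨ +-modˡ B (%-mod (k * k₂)) ⟩
        B + k * k₂                     ≈⟨ +-modˡ B (*-modˡ k k₂≡) ⟩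
        B + k * (1 + p-1 * w * B)      ≡⟨ lemma B k p-1 w ⟩
        B + k + B * (p-1 * (w * k))    ≈⟨ +-modˡ (B + k) (≡-mod-p⇒≡-mod-n (*-modˡ p-1 wk≡1)) ⟩
        B + k + B * (p-1 * 1)          ≡⟨ lemma′ B k p-1 ⟩
        k + B * (1 + p-1)              ≡⟨ cong (λ z → k + B * z) 1+[p-1]≡p ⟩
        k + B * p                      ≡⟨ cong (k +_) n≡Bp ⟨
        k + n                          ≈⟨ +-∣-mod ∣-refl ⟩
        k                              ∎
        where
        open ≡-mod-Reasoning n
        lemma : ∀ B k a w → B + k * (1 + a * w * B) ≡ B + k + B * (a * (w * k))
        lemma = solve-∀
        lemma′ : ∀ B k a → B + k + B * (a * 1) ≡ k + B * (1 + a)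
        lemma′ = solve-∀

    oneCoset⇒isPeriod : OneCoset n K n B → IsPeriod n K B
    oneCoset⇒isPeriod cosetB = oneCoset⇒B+K⊆K cosetB , oneCoset⇒K⊆B+K cosetB

    exactLevel⇒oneCoset : p ∣ B → ExactLevel n K B p → OneCoset n K n B
    exactLevel⇒oneCoset p∣B (y , c , y∈K , p∤c , y≡) t with v , vc≡1 ← inverse-mod-prime p-prime p∤c =
      (y ^ (t * v)) % n , ^-∈K y∈K (t * v) , (begin
        (y ^ (t * v)) % n        ≈⟨ %-mod _ ⟩
        y ^ (t * v)              ≈⟨ ^-mod (t * v) (subst (y ≡ 1 + B * c mod_) (sym n≡Bp) y≡) ⟩
        (1 + X) ^ (t * v)        ≈⟨ 1+X^i≡1+iX X (t * v) (∣n⇒∣m*n (triangle (t * v)) n∣X²) (∣-trans n∣X² (m∣m*n X)) ⟩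
        1 + t * v * X            ≡⟨ cong suc (lemma t v B c) ⟩
        1 + B * (t * (v * c))    ≈⟨ +-modˡ 1 (≡-mod-p⇒≡-mod-n (*-modˡ t vc≡1)) ⟩
        1 + B * (t * 1)          ≡⟨ cong suc (lemma′ B t) ⟩
        1 + t * B                ∎)
      where
      open ≡-mod-Reasoning n
      X : ℕ
      X = B * c
      n∣X² : n ∣ X * X
      n∣X² = subst₂ _∣_ (sym n≡Bp) (lemma″ B c) (*-monoʳ-∣ B (∣n⇒∣m*n c (∣m⇒∣m*n c p∣B)))
        where
        lemma″ : ∀ B c → B * (c * (B * c)) ≡ B * c * (B * c)
        lemma″ = solve-∀
      lemma : ∀ t v B c → t * v * (B * c) ≡ B * (t * (v * c))
      lemma = solve-∀
      lemma′ : ∀ B t → B * (t * 1) ≡ t * B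
      lemma′ = solve-∀

    exactLevel-n/p⇒¬trivialRadical : p ∣ B → ExactLevel n K B p → ¬ TrivialRadical n K
    exactLevel-n/p⇒¬trivialRadical p∣B level trivial =
      trivial B B>0 B<n (oneCoset⇒isPeriod (exactLevel⇒oneCoset p∣B level))
      where
      B>0 : 0 < B
      B>0 = n≢0⇒n>0 λ { refl → <-irrefl (sym n≡Bp) (>-nonZero⁻¹ n) }
      B<n : B < n
      B<n = subst (B <_) (sym n≡Bp) (m<m*n B p {{>-nonZero B>0}} (prime⇒1< p-prime))

  nonZero-∣n : ∀ B {m} → B * m ∣ n → NonZero B
  nonZero-∣n zero    0∣n = ⊥-elim (<-irrefl (sym (0∣⇒≡0 0∣n)) (>-nonZero⁻¹ n))
  nonZero-∣n (suc _) _   = _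

  oneCoset⇒prime∣ : ∀ {M x p} → Prime p → p ∣ n → p ∣ M → OneCoset n K M x → p ∣ x
  oneCoset⇒prime∣ {M} {x} {p} p-prime p∣n p∣M cosetX with p ∣? x
  ... | yes p∣x = p∣x
  ... | no  p∤x = ⊥-elim (∈K⇒∤ k∈K (prime⇒1< p-prime) p∣n (≡0-mod⇒∣ k≡0))
    where
    v : ℕ
    v = proj₁ (inverse-mod-prime p-prime p∤x)
    vx≡1 : v * x ≡ 1 mod p
    vx≡1 = proj₂ (inverse-mod-prime p-prime p∤x)
    p-1 : ℕ
    p-1 = p ∸ 1
    k : ℕ
    k = proj₁ (cosetX (p-1 * v))
    k∈K : T (K k)
    k∈K = proj₁ (proj₂ (cosetX (p-1 * v)))
    k≡0 : k ≡ 0 mod p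
    k≡0 = begin
      k                    ≈⟨ ≡-mod-weaken p∣M (proj₂ (proj₂ (cosetX (p-1 * v)))) ⟩
      1 + p-1 * v * x      ≡⟨ cong suc (*-assoc p-1 v x) ⟩
      1 + p-1 * (v * x)    ≈⟨ +-modˡ 1 (*-modˡ p-1 vx≡1) ⟩
      1 + p-1 * 1          ≡⟨ cong suc (*-identityʳ p-1) ⟩
      1 + p-1              ≡⟨ m+[n∸m]≡n (<⇒≤ (prime⇒1< p-prime)) ⟩
      p                    ≈⟨ ∣⇒≡0-mod ∣-refl ⟩
      0                    ∎
      where open ≡-mod-Reasoning p

  exactLevel⇒normalForm : ∀ {B p} .{{_ : NonZero B}} → Prime p → p ∣ n → ExactLevel n K B p
                        → ∃ λ c₀ → T (K (1 + B * c₀)) × ¬ p ∣ c₀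
  exactLevel⇒normalForm {B} {p} p-prime p∣n (zero , _ , 0∈K , _) = ⊥-elim (∈K⇒∤ 0∈K (prime⇒1< p-prime) p∣n (p ∣0))
  exactLevel⇒normalForm {B} {p} p-prime p∣n (suc X , c , y∈K , p∤c , y≡) =
    c₀ , subst (T ∘ K ∘ suc) X≡Bc₀ y∈K , λ p∣c₀ → p∤c (≡0-mod⇒∣ (mod-trans (mod-sym c₀≡c) (∣⇒≡0-mod p∣c₀)))
    where
    multiple : ∃ λ c₀ → (X ≡ B * c₀) × (c₀ ≡ c mod p)
    multiple = ≡-mod-B*p⇒multiple (suc-cancel-mod y≡)
    c₀ : ℕ
    c₀ = proj₁ multiple
    X≡Bc₀ : X ≡ B * c₀
    X≡Bc₀ = proj₁ (proj₂ multiple)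
    c₀≡c : c₀ ≡ c mod p
    c₀≡c = proj₂ (proj₂ multiple)

  ^-exactLevel : ∀ {B q p c₀} → B * q * p ∣ n → T (K (1 + B * c₀)) → ¬ p ∣ c₀
               → B * q * p ∣ triangle q * (B * c₀ * (B * c₀))
               → B * q * p ∣ B * c₀ * (B * c₀) * (B * c₀)
               → ExactLevel n K (B * q) p
  ^-exactLevel {B} {q} {p} {c₀} M∣n y∈K p∤c₀ M∣triangle M∣X³ =
    ((1 + B * c₀) ^ q) % n , c₀ , ^-∈K y∈K q , p∤c₀ , (begin
      ((1 + B * c₀) ^ q) % n  ≈⟨ ≡-mod-weaken M∣n (%-mod _) ⟩
      (1 + B * c₀) ^ q        ≈⟨ 1+X^i≡1+iX (B * c₀) q M∣triangle M∣X³ ⟩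
      1 + q * (B * c₀)        ≡⟨ cong suc (lemma q B c₀) ⟩
      1 + B * q * c₀          ∎)
    where
    open ≡-mod-Reasoning (B * q * p)
    lemma : ∀ q B c₀ → q * (B * c₀) ≡ B * q * c₀
    lemma = solve-∀

  odd-*2 : ∀ {B p c₀} → ¬ 2 ∣ B → 2 ∣ n → T (K (1 + B * c₀)) → ¬ p ∣ c₀ → ExactLevel n K (B * 2) p
  odd-*2 {B} {p} {c₀} 2∤B 2∣n y∈K p∤c₀ with even⊎odd (B * c₀)
  ... | inj₂ 2∣y = ⊥-elim (∈K⇒∤ y∈K (s≤s (s≤s z≤n)) 2∣n 2∣y)
  ... | inj₁ 2∣Bc₀ with euclidsLemma B c₀ prime[2] 2∣Bc₀
  ...   | inj₁ 2∣B = ⊥-elim (2∤B 2∣B)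
  ...   | inj₂ (divides c′ refl) =
    1 + B * (c′ * 2) , c′ , y∈K , (λ p∣c′ → p∤c₀ (∣m⇒∣m*n 2 p∣c′)) , mod-reflexive (cong suc (lemma B c′))
    where
    lemma : ∀ B c′ → B * (c′ * 2) ≡ B * 2 * c′
    lemma = solve-∀

  module _ {s : ℕ} (s∣n : s ∣ n) (oddPrimes : ∀ p → Prime p → p ≢ 2 → p ∣ n → p ∣ s) where

    -- q = p or q ∣ B: take q-th powers; q = 2 ∤ B: the unit 1 + B c₀ is odd, so 2 ∣ c₀;
    -- any other q would divide s ∣ B p.
    normalForm-*prime : ∀ {B p q c₀} → Prime p → Prime q → s ∣ B * p → p ∣ B → (p ≡ 2 → 4 ∣ B)
                      → B * p * q ∣ n → T (K (1 + B * c₀)) → ¬ p ∣ c₀ → ExactLevel n K (B * q) p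
    normalForm-*prime {B} {p} {q} {c₀} p-prime q-prime s∣Bp p∣B p≡2⇒4∣B Bpq∣n y∈K p∤c₀
      with q ≟ p | q ∣? B | q ≟ 2
    ... | yes refl | _       | _      =
      ^-exactLevel {B} {p} Bpq∣n y∈K p∤c₀ triangle-term (B*p*p∣[Bc]³ c₀ p∣B)
      where
      triangle-term : B * p * p ∣ triangle p * (B * c₀ * (B * c₀))
      triangle-term with p ≟ 2
      ... | yes refl = 4∣B⇒B*2*2∣triangle[Bc]² c₀ (p≡2⇒4∣B refl)
      ... | no  p≢2  = oddPrime⇒B*p*p∣triangle[Bc]² c₀ p-prime p≢2 p∣B
    ... | no q≢p   | yes q∣B | _      =
      ^-exactLevel {B} {q} Bqp∣n y∈K p∤c₀ (∣n⇒∣m*n (triangle q) Bqp∣X²) (∣-trans Bqp∣X² (m∣m*n (B * c₀)))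
      where
      Bqp∣n : B * q * p ∣ n
      Bqp∣n = subst (_∣ n) (lemma B p q) Bpq∣n
        where
        lemma : ∀ B p q → B * p * q ≡ B * q * p
        lemma = solve-∀
      Bqp∣X² : B * q * p ∣ B * c₀ * (B * c₀)
      Bqp∣X² = q*p∣B⇒B*q*p∣[Bc]² c₀ (distinctPrimes∣⇒*∣ p-prime q-prime q≢p p∣B q∣B)
    ... | no _     | no 2∤B  | yes refl = odd-*2 2∤B (∣-trans (n∣m*n (B * p)) Bpq∣n) y∈K p∤c₀
    ... | no q≢p   | no q∤B  | no q≢2   = ⊥-elim ([ q∤B , (λ q∣p → q≢p (prime∣prime⇒≡ p-prime q-prime q∣p)) ]′
      (euclidsLemma B p q-prime (∣-trans (oddPrimes q q-prime q≢2 (∣-trans (n∣m*n (B * p)) Bpq∣n)) s∣Bp)))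

    exactLevel-*prime : ∀ {B p q} → Prime p → Prime q → s ∣ B * p → p ∣ B → (p ≡ 2 → 4 ∣ B)
                      → B * p * q ∣ n → ExactLevel n K B p → ExactLevel n K (B * q) p
    exactLevel-*prime {B} {p} {q} p-prime q-prime s∣Bp p∣B p≡2⇒4∣B Bpq∣n level =
      normalForm-*prime p-prime q-prime s∣Bp p∣B p≡2⇒4∣B Bpq∣n (proj₁ (proj₂ normal)) (proj₂ (proj₂ normal))
      where
      normal : ∃ λ c₀ → T (K (1 + B * c₀)) × ¬ p ∣ c₀
      normal = exactLevel⇒normalForm {{nonZero-∣n B (subst (_∣ n) (*-assoc B p q) Bpq∣n)}}
                 p-prime (∣-trans (∣m⇒∣m*n q (n∣m*n B)) Bpq∣n) level

    -- Multiply B by the prime factors of m one at a time until B p = n.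
    exactLevel⇒¬trivialRadical : ∀ {p} → Prime p → ∀ {m} → Acc _<_ m → ∀ {B} → n ≡ m * (B * p)
                               → s ∣ B * p → p ∣ B → (p ≡ 2 → 4 ∣ B) → ExactLevel n K B p → ¬ TrivialRadical n K
    exactLevel⇒¬trivialRadical p-prime {zero} _ n≡0 _ _ _ _ _ =
      <-irrefl (sym n≡0) (>-nonZero⁻¹ n)
    exactLevel⇒¬trivialRadical {p} p-prime {1} _ {B} n≡1*Bp _ p∣B _ level =
      exactLevel-n/p⇒¬trivialRadical p-prime (trans n≡1*Bp (+-identityʳ (B * p))) p∣B level
    exactLevel⇒¬trivialRadical {p} p-prime {m@(suc (suc _))} (acc smaller) {B} n≡mBp s∣Bp p∣B p≡2⇒4∣B level =
      exactLevel⇒¬trivialRadical p-prime (smaller m′<m) n≡m′[Bq]p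
        (∣-trans s∣Bp (divides q (lemma B p q))) (∣m⇒∣m*n q p∣B) (∣m⇒∣m*n q ∘ p≡2⇒4∣B)
        (exactLevel-*prime p-prime q-prime s∣Bp p∣B p≡2⇒4∣B Bpq∣n level)
      where
      factor : ∃ λ q → Prime q × q ∣ m
      factor = ∃prime∣ (s≤s (s≤s z≤n))
      q : ℕ
      q = proj₁ factor
      q-prime : Prime q
      q-prime = proj₁ (proj₂ factor)
      m′ : ℕ
      m′ = quotient (proj₂ (proj₂ factor))
      m≡m′q : m ≡ m′ * q
      m≡m′q = _∣_.equality (proj₂ (proj₂ factor))
      lemma : ∀ B p q → B * q * p ≡ q * (B * p)
      lemma = solve-∀
      n≡m′[Bq]p : n ≡ m′ * (B * q * p)
      n≡m′[Bq]p = trans n≡mBp (trans (cong (_* (B * p)) m≡m′q) (lemma′ m′ q B p))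
        where
        lemma′ : ∀ m′ q B p → m′ * q * (B * p) ≡ m′ * (B * q * p)
        lemma′ = solve-∀
      Bpq∣n : B * p * q ∣ n
      Bpq∣n = divides m′ (trans n≡m′[Bq]p (lemma″ m′ B p q))
        where
        lemma″ : ∀ m′ B p q → m′ * (B * q * p) ≡ m′ * (B * p * q)
        lemma″ = solve-∀
      m′<m : m′ < m
      m′<m = subst (m′ <_) (sym m≡m′q) (m<m*n m′ q {{m′≢0}} (prime⇒1< q-prime))
        where
        m′≢0 : NonZero m′
        m′≢0 = ≢-nonZero λ m′≡0 → 1+n≢0 (trans m≡m′q (cong (_* q) m′≡0))

    module _ (trivial : TrivialRadical n K) where

      oneCoset⇒cofactor∣ : ∀ {B p} → Prime p → s ≡ B * p → OneCoset n K s B → p ∣ B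
      oneCoset⇒cofactor∣ {B} {p} p-prime s≡Bp =
        oneCoset⇒prime∣ p-prime (∣-trans p∣s s∣n) p∣s
        where
        p∣s : p ∣ s
        p∣s = subst (p ∣_) (sym s≡Bp) (n∣m*n B)

      oneCoset⇒¬4∣cofactor : ∀ {B p} → Prime p → s ≡ B * p → OneCoset n K s B → ¬ (p ≡ 2 → 4 ∣ B)
      oneCoset⇒¬4∣cofactor {B} {p} p-prime s≡Bp cosetB p≡2⇒4∣B =
        exactLevel⇒¬trivialRadical p-prime (<-wellFounded (quotient Bp∣n)) (_∣_.equality Bp∣n)
          (subst (s ∣_) s≡Bp ∣-refl) (oneCoset⇒cofactor∣ p-prime s≡Bp cosetB) p≡2⇒4∣B level trivial
        where
        Bp∣n : B * p ∣ n
        Bp∣n = subst (_∣ n) s≡Bp s∣n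
        k : ℕ
        k = proj₁ (cosetB 1)
        k≡ : k ≡ 1 + 1 * B mod s
        k≡ = proj₂ (proj₂ (cosetB 1))
        level : ExactLevel n K B p
        level = k , 1 , proj₁ (proj₂ (cosetB 1)) , (λ p∣1 → <-irrefl refl (≤-trans (prime⇒1< p-prime) (∣⇒≤ p∣1))) ,
                subst (k ≡_mod (B * p)) (cong suc (trans (*-identityˡ B) (sym (*-identityʳ B)))) (subst (k ≡ 1 + 1 * B mod_) s≡Bp k≡)

      oneCoset-cofactor : ∀ {B p} → Prime p → s ≡ B * p → OneCoset n K s B → p ≡ 2 × 4 ∣ s × ¬ 8 ∣ s
      oneCoset-cofactor {B} {p} p-prime s≡Bp cosetB with p ≟ 2
      ... | no  p≢2  = ⊥-elim (oneCoset⇒¬4∣cofactor p-prime s≡Bp cosetB (⊥-elim ∘ p≢2))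
      ... | yes refl = refl , 4∣s , 8∤s
        where
        4∣s : 4 ∣ s
        4∣s with divides b refl ← oneCoset⇒cofactor∣ p-prime s≡Bp cosetB = divides b (trans s≡Bp (*-assoc b 2 2))
        8∤s : ¬ 8 ∣ s
        8∤s (divides e s≡8e) = oneCoset⇒¬4∣cofactor p-prime s≡Bp cosetB λ _ →
          divides e (*-cancelʳ-≡ B (e * 4) 2 (begin
            B * 2      ≡⟨ s≡Bp ⟨
            s          ≡⟨ s≡8e ⟩
            e * 8      ≡⟨ *-assoc e 4 2 ⟨
            e * 4 * 2  ∎))
          where open ≡-Reasoning

      oneCoset⇒¬largeCofactor : ∀ {d e} → OneCoset n K s d → 3 ≤ e → s ≢ e * d
      oneCoset⇒¬largeCofactor {d} {e} cosetD 3≤e s≡ed with ≥3⇒oddPrime∣⊎4∣ e 3≤e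
      ... | inj₁ (p , p-prime , p≢2 , divides e′ refl) =
        p≢2 (proj₁ (oneCoset-cofactor p-prime (trans s≡ed (lemma e′ p d)) (cosetD* e′)))
        where
        lemma : ∀ e′ p d → e′ * p * d ≡ d * e′ * p
        lemma = solve-∀
        cosetD* : ∀ a → OneCoset n K s (d * a)
        cosetD* a = oneCoset-multiple a (mod-reflexive (*-comm d a)) cosetD
      ... | inj₂ (divides e′ refl) = 8∤s (divides f (begin
        s                ≡⟨ s≡ed ⟩
        e′ * 4 * d       ≡⟨ lemma e′ d ⟩
        d * e′ * 2 * 2   ≡⟨ cong (λ x → x * 2 * 2) de′≡2f ⟩
        f * 2 * 2 * 2    ≡⟨ lemma′ f ⟩
        f * 8            ∎))
        where
        open ≡-Reasoning
        lemma : ∀ e′ d → e′ * 4 * d ≡ d * e′ * 2 * 2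
        lemma = solve-∀
        lemma′ : ∀ f → f * 2 * 2 * 2 ≡ f * 8
        lemma′ = solve-∀
        cosetD* : ∀ a → OneCoset n K s (d * a)
        cosetD* a = oneCoset-multiple a (mod-reflexive (*-comm d a)) cosetD
        s≡de′2*2 : s ≡ d * e′ * 2 * 2
        s≡de′2*2 = trans s≡ed (lemma e′ d)
        8∤s : ¬ 8 ∣ s
        8∤s = proj₂ (proj₂ (oneCoset-cofactor prime[2] s≡de′2*2
                (subst (OneCoset n K s) (sym (*-assoc d e′ 2)) (cosetD* (e′ * 2)))))
        2∣s : 2 ∣ s
        2∣s = divides (d * e′ * 2) s≡de′2*2
        2∣de′ : 2 ∣ d * e′
        2∣de′ = oneCoset⇒prime∣ prime[2] (∣-trans 2∣s s∣n) 2∣s (cosetD* e′)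
        f : ℕ
        f = quotient 2∣de′
        de′≡2f : d * e′ ≡ f * 2
        de′≡2f = _∣_.equality 2∣de′

      -- d = gcd(j, s) is a multiple of j modulo s, so K also contains 1 + dℤ modulo s.
      oneCoset-bound : .{{_ : NonZero s}} → ∀ {j} → OneCoset n K s j → s ∣ 2 * j × (¬ s ∣ j → 4 ∣ s × ¬ 8 ∣ s)
      oneCoset-bound {j} cosetJ with Bézout.lemma j s
      ... | Bézout.result d (GCD.is (d∣j , divides e s≡ed) _) bézout = byCofactor e s≡ed
        where
        cosetD : OneCoset n K s d
        cosetD = oneCoset-multiple (proj₁ (bézout⇒≡-mod bézout)) (proj₂ (bézout⇒≡-mod bézout)) cosetJ
        byCofactor : ∀ e → s ≡ e * d → s ∣ 2 * j × (¬ s ∣ j → 4 ∣ s × ¬ 8 ∣ s)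
        byCofactor 0 s≡0 = ⊥-elim (<-irrefl (sym s≡0) (>-nonZero⁻¹ s))
        byCofactor 1 s≡d = ∣n⇒∣m*n 2 s∣j , λ s∤j → ⊥-elim (s∤j s∣j)
          where
          s∣j : s ∣ j
          s∣j = subst (_∣ j) (sym (trans s≡d (+-identityʳ d))) d∣j
        byCofactor 2 s≡2d =
          subst (_∣ 2 * j) (sym s≡2d) (*-monoʳ-∣ 2 d∣j) ,
          λ _ → proj₂ (oneCoset-cofactor prime[2] (trans s≡2d (*-comm 2 d)) cosetD)
        byCofactor e@(suc (suc (suc _))) s≡ed =
          ⊥-elim (oneCoset⇒¬largeCofactor {e = e} cosetD (s≤s (s≤s (s≤s z≤n))) s≡ed)

module Section {n : ℕ} .{{_ : NonZero n}} {K : Subset} (aut : IsAutSubgroup n K) (trivial : TrivialRadical n K)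
         {U L : Subset} (aU : IsAGroup n K U) (aL : IsAGroup n K L) (L⊆U : ∀ x → T (L x) → T (U x))
         (oddPrimes : ∀ p → Prime p → p ≢ 2 → p ∣ n → p ∣ secOrder n U L)
         {u : ℕ} (u∈U : T (U u)) (generator : T (isGenerator n U L u)) where

  open IsAutSubgroup aut
  mU : Multiples U
  mU = subgroup⇒multiples (IsAGroup.subgroup aU)

  mL : Multiples L
  mL = subgroup⇒multiples (IsAGroup.subgroup aL)

  open Multiples mU public using ()
    renaming (base to cU; base>0 to cU>0; base∣n to cU∣n; ∈⇒∣ to ∈U⇒cU∣; ∣⇒∈ to cU∣⇒∈U)
  open Multiples mL public using ()
    renaming (base to cL; base>0 to cL>0; base∣n to cL∣n; ∈⇒∣ to ∈L⇒cL∣; ∣⇒∈ to cL∣⇒∈L)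

  instance
    cU≢0 : NonZero cU
    cU≢0 = >-nonZero cU>0

  cU∣cL : cU ∣ cL
  cU∣cL with cL <? n
  ... | yes cL<n = ∈U⇒cU∣ (L⊆U cL (cL∣⇒∈L cL<n ∣-refl))
  ... | no  cL≮n = subst (cU ∣_) (sym (≤-antisym (∣⇒≤ cL∣n) (≮⇒≥ cL≮n))) cU∣n

  s : ℕ
  s = quotient cU∣cL

  cL≡s*cU : cL ≡ s * cU
  cL≡s*cU = _∣_.equality cU∣cL

  instance
    s≢0 : NonZero s
    s≢0 = ≢-nonZero λ s≡0 → <-irrefl (sym (trans cL≡s*cU (cong (_* cU) s≡0))) cL>0

  s∣n : s ∣ n
  s∣n = ∣-trans (divides cU (trans cL≡s*cU (*-comm s cU))) cL∣n

  secOrder≡s : secOrder n U L ≡ s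
  secOrder≡s = secOrder≡ mU mL cL≡s*cU

  w : ℕ
  w = quotient (∈U⇒cU∣ u∈U)

  u≡w*cU : u ≡ w * cU
  u≡w*cU = _∣_.equality (∈U⇒cU∣ u∈U)

  cancel-cU : ∀ {a b} → a * cU ≡ b * cU mod cL → a ≡ b mod s
  cancel-cU {a} {b} eq = *-cancel-mod cU (subst (a * cU ≡ b * cU mod_) cL≡s*cU eq)

  ∈L⇒≡0-mod-cL : ∀ {l} → T (L l) → l ≡ 0 mod cL
  ∈L⇒≡0-mod-cL l∈L = ∣⇒≡0-mod (∈L⇒cL∣ l∈L)

  -- u + L generates U/L, so some multiple of u lies in cU + L.
  w-invertible : ∃ λ m → m * w ≡ 1 mod s
  w-invertible with cU <? n
  ... | yes cU<n = m , cancel-cU (begin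
    m * w * cU      ≡⟨ *-assoc m w cU ⟩
    m * (w * cU)    ≡⟨ cong (m *_) u≡w*cU ⟨
    m * u           ≡⟨ +-identityʳ _ ⟨
    m * u + 0       ≈⟨ +-modˡ (m * u) (∈L⇒≡0-mod-cL l∈L) ⟨
    m * u + l       ≈⟨ ≡-mod-weaken cL∣n (%-mod (m * u + l)) ⟨
    (m * u + l) % n ≡⟨ m*u+l≡cU ⟩
    cU              ≡⟨ *-identityˡ cU ⟨
    1 * cU          ∎)
    where
    open ≡-mod-Reasoning cL
    generated : ∃₂ λ m l → T (L l) × (m * u + l) % n ≡ cU
    generated = isGenerator⁻ generator cU<n (cU∣⇒∈U cU<n ∣-refl)
    m : ℕ
    m = proj₁ generated
    l : ℕ
    l = proj₁ (proj₂ generated)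
    l∈L : T (L l)
    l∈L = proj₁ (proj₂ (proj₂ generated))
    m*u+l≡cU : (m * u + l) % n ≡ cU
    m*u+l≡cU = proj₂ (proj₂ (proj₂ generated))
  ... | no  cU≮n = 0 , subst (0 * w ≡ 1 mod_) (sym s≡1) mod-1
    where
    cU≡n : cU ≡ n
    cU≡n = ≤-antisym (∣⇒≤ cU∣n) (≮⇒≥ cU≮n)
    s≡1 : s ≡ 1
    s≡1 = ≤-antisym (*-cancelʳ-≤ s 1 cU (subst (_≤ 1 * cU) cL≡s*cU (subst (cL ≤_) lemma (∣⇒≤ cL∣n))))
                    (>-nonZero⁻¹ s)
      where
      lemma : n ≡ 1 * cU
      lemma = trans (sym cU≡n) (sym (*-identityˡ cU))

  m : ℕ
  m = proj₁ w-invertible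

  m*w≡1 : m * w ≡ 1 mod s
  m*w≡1 = proj₂ w-invertible

  Y : Subset
  Y = basicPre n K L u

  InRadical : ℕ → Set
  InRadical g = T (U g ∧ isCanonRep n L g ∧ stabilises n Y g)

  u<n : u < n
  u<n = IsSubgroup.inG (IsAGroup.subgroup aU) u u∈U

  u∈Y : T (Y u)
  u∈Y = subst (T ∘ Y) 1·u+0≡u (basicPre⁺ (m%n<n 1 n) (>-nonZero⁻¹ n) one (IsSubgroup.zero∈ (IsAGroup.subgroup aL)))
    where
    1·u+0≡u : ((1 % n) * u + 0) % n ≡ u
    1·u+0≡u = trans (cong (λ z → (z + 0) % n) (*-comm (1 % n) u)) ([k*[1%m]+0]%m≡k u<n)

  stabilises⇒translates∈Y : ∀ {g} → T (stabilises n Y g) → ∀ t → T (Y ((t * g + u) % n))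
  stabilises⇒translates∈Y stable zero    = subst (T ∘ Y) (sym (m<n⇒m%n≡m u<n)) u∈Y
  stabilises⇒translates∈Y {g} stable (suc t) =
    subst (T ∘ Y) (≡-mod⇒%≡ shift) (stabilises⁻ {Y = Y} stable (m%n<n _ n) (stabilises⇒translates∈Y stable t))
    where
    shift : g + (t * g + u) % n ≡ suc t * g + u mod n
    shift = mod-trans (+-modˡ g (%-mod (t * g + u))) (mod-reflexive (sym (+-assoc g (t * g) u)))

  ∈Y⇒orbit : ∀ {x} → T (Y x) → ∃ λ k → T (K k) × k * u ≡ x mod cL
  ∈Y⇒orbit {x} x∈Y = k , k∈K , (begin
    k * u            ≡⟨ +-identityʳ _ ⟨
    k * u + 0        ≈⟨ +-modˡ (k * u) (∈L⇒≡0-mod-cL l∈L) ⟨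
    k * u + l        ≈⟨ ≡-mod-weaken cL∣n (%-mod (k * u + l)) ⟨
    (k * u + l) % n  ≡⟨ sum≡x ⟩
    x                ∎)
    where
    open ≡-mod-Reasoning cL
    decomposition : ∃₂ λ k l → T (K k) × T (L l) × (k * u + l) % n ≡ x
    decomposition = basicPre⁻ x∈Y
    k : ℕ
    k = proj₁ decomposition
    l : ℕ
    l = proj₁ (proj₂ decomposition)
    k∈K : T (K k)
    k∈K = proj₁ (proj₂ (proj₂ decomposition))
    l∈L : T (L l)
    l∈L = proj₁ (proj₂ (proj₂ (proj₂ decomposition)))
    sum≡x : (k * u + l) % n ≡ x
    sum≡x = proj₂ (proj₂ (proj₂ (proj₂ decomposition)))

  orbit-of-translate : ∀ {g j t k} → g ≡ j * cU → k * u ≡ (t * g + u) % n mod cL → k * w ≡ t * j + w mod s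
  orbit-of-translate {g} {j} {t} {k} g≡j*cU ku≡ = cancel-cU (begin
    k * w * cU             ≡⟨ *-assoc k w cU ⟩
    k * (w * cU)           ≡⟨ cong (k *_) u≡w*cU ⟨
    k * u                  ≈⟨ ku≡ ⟩
    (t * g + u) % n        ≈⟨ ≡-mod-weaken cL∣n (%-mod (t * g + u)) ⟩
    t * g + u              ≡⟨ cong₂ (λ a b → t * a + b) g≡j*cU u≡w*cU ⟩
    t * (j * cU) + w * cU  ≡⟨ lemma t j cU w ⟩
    (t * j + w) * cU       ∎)
    where
    open ≡-mod-Reasoning cL
    lemma : ∀ t j cU w → t * (j * cU) + w * cU ≡ (t * j + w) * cU
    lemma = solve-∀

  -- Every t·g + u lies in K·u + L; dividing by u = w·cU modulo cL gives k ≡ 1 + t·j·m (mod s).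
  stabilises⇒oneCoset : ∀ {g j} → g ≡ j * cU → T (stabilises n Y g) → OneCoset n K s (j * m)
  stabilises⇒oneCoset {g} {j} g≡j*cU stable t = k , k∈K , (begin
    k                    ≡⟨ *-identityʳ k ⟨
    k * 1                ≈⟨ *-modˡ k m*w≡1 ⟨
    k * (m * w)          ≡⟨ lemma k m w ⟩
    m * (k * w)          ≈⟨ *-modˡ m (orbit-of-translate {j = j} {t} {k} g≡j*cU (proj₂ (proj₂ orbit))) ⟩
    m * (t * j + w)      ≡⟨ lemma′ m t j w ⟩
    m * w + t * (j * m)  ≈⟨ +-modʳ (t * (j * m)) m*w≡1 ⟩
    1 + t * (j * m)      ∎)
    where
    open ≡-mod-Reasoning s
    orbit : ∃ λ k → T (K k) × k * u ≡ (t * g + u) % n mod cL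
    orbit = ∈Y⇒orbit (stabilises⇒translates∈Y stable t)
    k : ℕ
    k = proj₁ orbit
    k∈K : T (K k)
    k∈K = proj₁ (proj₂ orbit)
    lemma : ∀ k m w → k * (m * w) ≡ m * (k * w)
    lemma = solve-∀
    lemma′ : ∀ m t j w → m * (t * j + w) ≡ m * w + t * (j * m)
    lemma′ = solve-∀

  oddPrime∣s : ∀ p → Prime p → p ≢ 2 → p ∣ n → p ∣ s
  oddPrime∣s p p-prime p≢2 p∣n = subst (p ∣_) secOrder≡s (oddPrimes p p-prime p≢2 p∣n)

  oneCoset[j*m]⇒j≡0⊎2j≡s : ∀ {j} → j < s → OneCoset n K s (j * m)
                         → (j ≡ 0 ⊎ 2 * j ≡ s) × (j ≢ 0 → 4 ∣ s × ¬ 8 ∣ s)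
  oneCoset[j*m]⇒j≡0⊎2j≡s {j} j<s cosetJM =
    n∣2*m⇒m≡0⊎2*m≡n j<s (s∣a*jm⇒s∣a*j 2 (proj₁ bound)) ,
    λ j≢0 → proj₂ bound λ s∣jm → <⇒≱ j<s (∣⇒≤ {{≢-nonZero j≢0}} (s∣jm⇒s∣j s∣jm))
    where
    bound : s ∣ 2 * (j * m) × (¬ s ∣ j * m → 4 ∣ s × ¬ 8 ∣ s)
    bound = oneCoset-bound aut s∣n oddPrime∣s trivial cosetJM
    jmw≡j : j * m * w ≡ j mod s
    jmw≡j = mod-trans (mod-reflexive (*-assoc j m w)) (mod-trans (*-modˡ j m*w≡1) (mod-reflexive (*-identityʳ j)))
    s∣a*jm⇒s∣a*j : ∀ a → s ∣ a * (j * m) → s ∣ a * j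
    s∣a*jm⇒s∣a*j a s∣ajm = ≡0-mod⇒∣ (mod-trans (mod-sym (*-modˡ a jmw≡j))
      (mod-trans (mod-reflexive (sym (*-assoc a (j * m) w))) (∣⇒≡0-mod (∣m⇒∣m*n w s∣ajm))))
    s∣jm⇒s∣j : s ∣ j * m → s ∣ j
    s∣jm⇒s∣j s∣jm = subst (s ∣_) (*-identityˡ j) (s∣a*jm⇒s∣a*j 1 (subst (s ∣_) (sym (*-identityˡ (j * m))) s∣jm))

  radical-shape : ∀ {g} → g < n → InRadical g → (g ≡ 0 ⊎ g * 2 ≡ cL) × (g ≢ 0 → 4 ∣ s × ¬ 8 ∣ s)
  radical-shape {g} g<n g∈rad =
    Sum.map (λ j≡0 → trans g≡j*cU (cong (_* cU) j≡0)) 2j≡s⇒2g≡cL (proj₁ shape) ,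
    λ g≢0 → proj₂ shape λ j≡0 → g≢0 (trans g≡j*cU (cong (_* cU) j≡0))
    where
    g∈U : T (U g)
    g∈U = proj₁ (T-∧⁻ {U g} g∈rad)
    canonical : T (isCanonRep n L g)
    canonical = proj₁ (T-∧⁻ {isCanonRep n L g} (proj₂ (T-∧⁻ {U g} g∈rad)))
    stable : T (stabilises n Y g)
    stable = proj₂ (T-∧⁻ {isCanonRep n L g} (proj₂ (T-∧⁻ {U g} g∈rad)))
    j : ℕ
    j = quotient (∈U⇒cU∣ g∈U)
    g≡j*cU : g ≡ j * cU
    g≡j*cU = _∣_.equality (∈U⇒cU∣ g∈U)
    j<s : j < s
    j<s = *-cancelʳ-< cU j s (subst₂ _<_ g≡j*cU cL≡s*cU (canonical⇒<base mL g<n canonical))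
    shape : (j ≡ 0 ⊎ 2 * j ≡ s) × (j ≢ 0 → 4 ∣ s × ¬ 8 ∣ s)
    shape = oneCoset[j*m]⇒j≡0⊎2j≡s j<s (stabilises⇒oneCoset {j = j} g≡j*cU stable)
    2j≡s⇒2g≡cL : 2 * j ≡ s → g * 2 ≡ cL
    2j≡s⇒2g≡cL 2j≡s = begin
      g * 2       ≡⟨ cong (_* 2) g≡j*cU ⟩
      j * cU * 2  ≡⟨ lemma j cU ⟩
      2 * j * cU  ≡⟨ cong (_* cU) 2j≡s ⟩
      s * cU      ≡⟨ cL≡s*cU ⟨
      cL          ∎
      where
      open ≡-Reasoning
      lemma : ∀ j cU → j * cU * 2 ≡ 2 * j * cU
      lemma = solve-∀

  0∈radical : InRadical 0
  0∈radical = T-∧⁺ (cU∣⇒∈U (>-nonZero⁻¹ n) (_ ∣0)) (T-∧⁺ (<base⇒canonical mL cL>0)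
    (stabilises⁺ (λ x x<n x∈Y → subst (T ∘ Y) (sym (m<n⇒m%n≡m x<n)) x∈Y)
                 (λ x x<n x∈Y → x , x<n , x∈Y , m<n⇒m%n≡m x<n)))

theorem7p3 : (n : ℕ) .{{_ : NonZero n}} (K : Subset) → IsAutSubgroup n K
    → radCount n K (wholeG n) (trivialG n) (1 % n) ≡ 1
    → (U L : Subset) → IsAGroup n K U → IsAGroup n K L → (∀ x → T (L x) → T (U x))
    → (∀ p → Prime p → p ≢ 2 → p ∣ n → p ∣ secOrder n U L)
    → (u : ℕ) → T (U u) → T (isGenerator n U L u)
    → (radCount n K U L u ≤ 2)
      × (radCount n K U L u ≢ 1 → (4 ∣ secOrder n U L) × ¬ (8 ∣ secOrder n U L))
theorem7p3 n K aut radCount≡1 U L aU aL L⊆U oddPrimes u u∈U generator =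
  countBelow-≤2 n _ 0 (cL / 2) radical⊆0∪half , nontrivialRadical⇒4∣s
  where
  open Section aut (radCount≡1⇒trivialRadical aut radCount≡1) aU aL L⊆U oddPrimes u∈U generator
  radical⊆0∪half : ∀ g → g < n → InRadical g → g ≡ 0 ⊎ g ≡ cL / 2
  radical⊆0∪half g g<n g∈rad = Sum.map₂ (λ 2g≡cL → trans (sym (m*n/n≡m g 2)) (cong (_/ 2) 2g≡cL))
                                        (proj₁ (radical-shape g<n g∈rad))
  nontrivialRadical⇒4∣s : radCount n K U L u ≢ 1 → 4 ∣ secOrder n U L × ¬ 8 ∣ secOrder n U L
  nontrivialRadical⇒4∣s count≢1 =
    subst (λ z → 4 ∣ z × ¬ 8 ∣ z) (sym secOrder≡s) (proj₂ (radical-shape g<n g∈rad) g≢0)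
    where
    nonzero : ∃ λ g → g < n × InRadical g × g ≢ 0
    nonzero = countBelow≢1 n _ 0 (>-nonZero⁻¹ n) 0∈radical count≢1
    g : ℕ
    g = proj₁ nonzero
    g<n : g < n
    g<n = proj₁ (proj₂ nonzero)
    g∈rad : InRadical g
    g∈rad = proj₁ (proj₂ (proj₂ nonzero))
    g≢0 : g ≢ 0
    g≢0 = proj₂ (proj₂ (proj₂ nonzero))
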